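{- For all integers $m,n\ge 3$, \[\textup{aw}(C_m\square C_n,3)=\begin{cases}4 & \text{if $m$ and $n$ are even and $\textup{diam}(C_m\square C_n)$ is odd,}\\ 3 & \text{otherwise.}\end{cases}\]
   Context: All graphs are finite, simple and undirected; $\textup{d}(u,v)$ denotes shortest-path distance and $\textup{diam}$ the diameter. $C_n$ is the cycle on $n$ vertices. The Cartesian product $G\square H$ has vertex set $V(G)\times V(H)$, with $(x,y)$ adjacent to $(x',y')$ iff either $x=x'$ and $yy'\in E(H)$, or $y=y'$ and $xx'\in E(G)$. A 3-term arithmetic progression (3-AP) in a graph is a set of vertices $\{v_1,v_2,v_3\}$ (listed in some order) with $\textup{d}(v_1,v_2)=\textup{d}(v_2,v_3)$. An exact $r$-coloring of a graph $G$ is a surjective map $c:V(G)\to\{1,\dots,r\}$; a set of vertices is rainbow under $c$ if its vertices receive pairwise distinct colors. The anti-van der Waerden number $\textup{aw}(G,3)$ is the least positive integer $r$ such that every exact $r$-coloring of $G$ contains a rainbow 3-AP; if no coloring of $V(G)$ yields a rainbow 3-AP, then $\textup{aw}(G,3)=|V(G)|+1$. -}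

module Defs where

open import Level using (0ℓ)
open import Data.Nat using (ℕ; zero; suc; _+_; _<_; _≤_; _%_)
open import Data.Fin using (Fin; toℕ)
open import Data.Product using (Σ; ∃; _×_; _,_)
open import Data.Sum using (_⊎_)
open import Relation.Binary.PropositionalEquality using (_≡_; _≢_)
open import Relation.Nullary using (¬_)

record Graph : Set₁ where
  field
    V   : Set
    Adj : V → V → Set
open Graph public

data Walk (G : Graph) : V G → V G → ℕ → Set where
  here : ∀ {u} → Walk G u u 0
  step : ∀ {u v w k} → Adj G u v → Walk G v w k → Walk G u w (suc k)

Dist : (G : Graph) → V G → V G → ℕ → Set
Dist G u v k = Walk G u v k × (∀ j → j < k → ¬ Walk G u v j)

IsDiam : Graph → ℕ → Set
IsDiam G D = (∃ λ u → ∃ λ v → Dist G u v D)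
           × (∀ u v k → Dist G u v k → k ≤ D)

CycSucc : (m : ℕ) → Fin m → Fin m → Set
CycSucc m i j = (toℕ j ≡ suc (toℕ i)) ⊎ ((suc (toℕ i) ≡ m) × (toℕ j ≡ 0))

Cycle : (m : ℕ) → Graph
Cycle m = record
  { V   = Fin m
  ; Adj = λ i j → CycSucc m i j ⊎ CycSucc m j i
  }

_□_ : Graph → Graph → Graph
G □ H = record
  { V   = V G × V H
  ; Adj = λ { (x , y) (x' , y') → (x ≡ x' × Adj H y y') ⊎ (y ≡ y' × Adj G x x') }
  }

-- Exact r-coloring: a surjective map V → Fin r.
Surjective : ∀ {A B : Set} → (A → B) → Set
Surjective {A} {B} f = ∀ (b : B) → ∃ λ a → f a ≡ b

HasRainbow3AP : (G : Graph) {r : ℕ} → (V G → Fin r) → Set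
HasRainbow3AP G c =
  ∃ λ v₁ → ∃ λ v₂ → ∃ λ v₃ →
    (∃ λ k → Dist G v₁ v₂ k × Dist G v₂ v₃ k)
    × c v₁ ≢ c v₂ × c v₂ ≢ c v₃ × c v₁ ≢ c v₃

AllColoringsRainbow : Graph → ℕ → Set
AllColoringsRainbow G r = (c : V G → Fin r) → Surjective c → HasRainbow3AP G c

-- aw(G,3) = r : r is the least positive integer such that every exact
-- r-coloring contains a rainbow 3-AP.  (For finite G with |V| = N this
-- least r always exists and is ≤ N+1, since for r > N there are no exact
-- r-colorings; this agrees with the convention aw = N+1.)
IsAw3 : Graph → ℕ → Set
IsAw3 G r = 1 ≤ r × AllColoringsRainbow G r
          × (∀ s → 1 ≤ s → s < r → ¬ AllColoringsRainbow G s)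

open import Data.Nat.Divisibility using (_∣_)

Even : ℕ → Set
Even n = 2 ∣ n

Odd : ℕ → Set
Odd n = ¬ (2 ∣ n)

module Submission where

-- Distances on C_m □ C_n are sums of cyclic distances, so the diameter is ⌊m/2⌋ + ⌊n/2⌋.
-- Upper bound: in a 3-colouring take an edge u — v and a vertex w with three distinct colours and
-- d(w, v) = d(w, u) + 1, and descend on d(w, u): either a rainbow 3-AP appears or such a configuration
-- with smaller d(w, u) does. Corner vertices of the torus settle every case except d(w, v) = diameter;
-- there an even diameter yields a midpoint, an odd side a second farthest vertex, and if both sides
-- are even and the diameter odd, the colour classes of v and w are singletons. Merging the colours of
-- a 4-colouring in two ways would then make all four classes singletons.
-- Lower bound: colouring a vertex, its antipode and all other vertices differently leaves no rainbow
-- 3-AP when the diameter is odd, as no vertex is equidistant from two antipodes.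

open import Defs
open import Data.Nat
open import Data.Nat.Properties
open import Data.Nat.DivMod using (_/_; _%_; m≡m%n+[m/n]*n; m%n<n; m%n≤m; m%n%n≡m%n; %-distribˡ-+; [m+n]%n≡m%n; m<n⇒m%n≡m; n%n≡0; m≥n⇒m/n>0)
open import Data.Nat.Divisibility using (_∣_; _∣?_; divides; n∣m⇒m%n≡0; m%n≡0⇒n∣m)
open import Data.Nat.Induction using (<-rec)
open import Data.Nat.Tactic.RingSolver using (solve-∀)
open import Algebra.Properties.CommutativeSemigroup +-commutativeSemigroup using (interchange; xy∙z≈y∙xz)
open import Data.Empty using (⊥; ⊥-elim)
open import Data.Fin using (Fin; zero; suc; toℕ; fromℕ<; punchOut) renaming (_≟_ to _≟ᶠ_)
open import Data.Fin.Patterns using (0F; 1F; 2F; 3F)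
open import Data.Fin.Properties using (punchOut-injective; injective⇒≤; *↔×; toℕ-fromℕ<; toℕ-injective; toℕ<n)
open import Data.Product using (Σ; ∃; ∃-syntax; _×_; _,_; proj₁; proj₂)
open import Data.Product.Properties using (≡-dec)
open import Data.Sum using (_⊎_; inj₁; inj₂; map; map₁; map₂; [_,_]′)
open import Function using (_∘_; id; const)
open import Function.Bundles using (Injection)
open import Function.Definitions using (Injective)
open import Function.Properties.Inverse using (↔⇒↣)
open import Relation.Binary.Definitions using (DecidableEquality; tri<; tri≈; tri>)
open import Relation.Binary.PropositionalEquality
open import Relation.Nullary using (¬_; yes; no; contradiction)

-- Arithmetic and finite sets

[m%d+n]%d≡[m+n]%d : ∀ m n d .{{_ : NonZero d}} → (m % d + n) % d ≡ (m + n) % d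
[m%d+n]%d≡[m+n]%d m n d = begin
  (m % d + n) % d            ≡⟨ %-distribˡ-+ (m % d) n d ⟩
  (m % d % d + n % d) % d    ≡⟨ cong (λ x → (x + n % d) % d) (m%n%n≡m%n m d) ⟩
  (m % d + n % d) % d        ≡⟨ %-distribˡ-+ m n d ⟨
  (m + n) % d                ∎
  where open ≡-Reasoning

[n∸k]+[n∸l]≡[n∸[k+l]]+n : ∀ {k l n} → k + l ≤ n → (n ∸ k) + (n ∸ l) ≡ (n ∸ (k + l)) + n
[n∸k]+[n∸l]≡[n∸[k+l]]+n {k} {l} k+l≤n with m≤n⇒∃[o]m+o≡n k+l≤n
... | r , refl = begin
  (k + l + r ∸ k) + (k + l + r ∸ l)     ≡⟨ cong₂ _+_ (cong (_∸ k) (+-assoc k l r)) (cong (_∸ l) (xy∙z≈y∙xz k l r)) ⟩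
  (k + (l + r) ∸ k) + (l + (k + r) ∸ l) ≡⟨ cong₂ _+_ (m+n∸m≡n k (l + r)) (m+n∸m≡n l (k + r)) ⟩
  (l + r) + (k + r)                     ≡⟨ shuffle k l r ⟩
  r + (k + l + r)                       ≡⟨ cong (_+ (k + l + r)) (m+n∸m≡n (k + l) r) ⟨
  (k + l + r ∸ (k + l)) + (k + l + r)   ∎
  where
  open ≡-Reasoning
  shuffle : ∀ k l r → (l + r) + (k + r) ≡ r + (k + l + r)
  shuffle = solve-∀

m≤n≤1+m⇒n≡m⊎n≡1+m : ∀ {m n} → m ≤ n → n ≤ suc m → n ≡ m ⊎ n ≡ suc m
m≤n≤1+m⇒n≡m⊎n≡1+m m≤n n≤1+m with m≤n⇒m<n∨m≡n n≤1+m
... | inj₁ n<1+m = inj₁ (≤-antisym (≤-pred n<1+m) m≤n)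
... | inj₂ n≡1+m = inj₂ n≡1+m

split-below : ∀ a {A B} → 1 ≤ A → 1 ≤ B → a + 2 ≤ A + B → ∃ λ s → ∃ λ t → s + t ≡ a × s < A × t < B
split-below a {A} {B} 1≤A 1≤B a+2≤A+B with suc a ≤? A
... | yes a<A = a , 0 , +-identityʳ a , a<A , 1≤B
... | no a≮A  = A ∸ 1 , suc a ∸ A , sum , A∸1<A , t<B
  where
  A≤1+a : A ≤ suc a
  A≤1+a = ≤-trans (≤-pred (≰⇒> a≮A)) (n≤1+n a)
  A∸1<A : A ∸ 1 < A
  A∸1<A = subst (A ∸ 1 <_) (m+[n∸m]≡n 1≤A) ≤-refl
  sum : A ∸ 1 + (suc a ∸ A) ≡ a
  sum = begin
    A ∸ 1 + (suc a ∸ A)   ≡⟨ +-∸-assoc (A ∸ 1) A≤1+a ⟨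
    (A ∸ 1 + suc a) ∸ A   ≡⟨ cong (_∸ A) (+-suc (A ∸ 1) a) ⟩
    (suc (A ∸ 1) + a) ∸ A ≡⟨ cong (λ x → (x + a) ∸ A) (m+[n∸m]≡n 1≤A) ⟩
    (A + a) ∸ A           ≡⟨ m+n∸m≡n A a ⟩
    a                     ∎
    where open ≡-Reasoning
  t<B : suc a ∸ A < B
  t<B = +-cancelˡ-≤ A _ _ (begin
    A + suc (suc a ∸ A)   ≡⟨ +-suc A (suc a ∸ A) ⟩
    suc (A + (suc a ∸ A)) ≡⟨ cong suc (m+[n∸m]≡n A≤1+a) ⟩
    suc (suc a)           ≡⟨ +-comm 2 a ⟩
    a + 2                 ≤⟨ a+2≤A+B ⟩
    A + B                 ∎)
    where open ≤-Reasoning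

fin2-cases : {a b : Fin 2} → a ≢ b → ∀ k → k ≡ a ⊎ k ≡ b
fin2-cases {0F} {0F} a≢b _  = contradiction refl a≢b
fin2-cases {0F} {1F} _   0F = inj₁ refl
fin2-cases {0F} {1F} _   1F = inj₂ refl
fin2-cases {1F} {0F} _   0F = inj₂ refl
fin2-cases {1F} {0F} _   1F = inj₁ refl
fin2-cases {1F} {1F} a≢b _  = contradiction refl a≢b

fin3-cases : {x y z : Fin 3} → x ≢ y → y ≢ z → x ≢ z → ∀ k → k ≡ x ⊎ k ≡ y ⊎ k ≡ z
fin3-cases {x} x≢y y≢z x≢z k with k ≟ᶠ x
... | yes k≡x = inj₁ k≡x
... | no k≢x with fin2-cases (y≢z ∘ punchOut-injective x≢y x≢z) (punchOut (k≢x ∘ sym))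
...   | inj₁ k≡y = inj₂ (inj₁ (punchOut-injective (k≢x ∘ sym) x≢y k≡y))
...   | inj₂ k≡z = inj₂ (inj₂ (punchOut-injective (k≢x ∘ sym) x≢z k≡z))

third-colour : (i j : Fin 3) → i ≢ j → ∃[ k ] (k ≢ i × k ≢ j)
third-colour 0F 1F _ = 2F , (λ ()) , (λ ())
third-colour 0F 2F _ = 1F , (λ ()) , (λ ())
third-colour 1F 0F _ = 2F , (λ ()) , (λ ())
third-colour 1F 2F _ = 0F , (λ ()) , (λ ())
third-colour 2F 0F _ = 1F , (λ ()) , (λ ())
third-colour 2F 1F _ = 0F , (λ ()) , (λ ())
third-colour 0F 0F i≢j = contradiction refl i≢j
third-colour 1F 1F i≢j = contradiction refl i≢j
third-colour 2F 2F i≢j = contradiction refl i≢j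

fin-choice : ∀ {k} {B : Set} (P : Fin k → Set) → (∀ i → P i ⊎ B) → (∀ i → P i) ⊎ B
fin-choice {zero}  P choose = inj₁ λ ()
fin-choice {suc k} P choose with choose zero | fin-choice (P ∘ suc) (choose ∘ suc)
... | inj₂ b  | _       = inj₂ b
... | inj₁ _  | inj₂ b  = inj₂ b
... | inj₁ p₀ | inj₁ ps = inj₁ λ { zero → p₀ ; (suc i) → ps i }

fin²-choice : ∀ {k l} {B : Set} (P : Fin k × Fin l → Set) → (∀ x → P x ⊎ B) → (∀ x → P x) ⊎ B
fin²-choice P choose =
  map₁ (λ all (i , j) → all i j) (fin-choice (λ i → ∀ j → P (i , j)) (λ i → fin-choice (λ j → P (i , j)) (λ j → choose (i , j))))

-- Graph distance and colourings

module _ {G : Graph} where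

  _++ᵂ_ : ∀ {x y z k l} → Walk G x y k → Walk G y z l → Walk G x z (k + l)
  here       ++ᵂ q = q
  step e p   ++ᵂ q = step e (p ++ᵂ q)


-- A symmetric function δ that drops by at most one along an edge and is realised by walks is the graph distance.
module GraphDistance (G : Graph) (δ : V G → V G → ℕ)
  (δ-refl : ∀ x → δ x x ≡ 0)
  (δ-sym : ∀ x y → δ y x ≡ δ x y)
  (adjacent-sym : ∀ {x y} → Adj G x y → Adj G y x)
  (δ-edge : ∀ {x x'} y → Adj G x x' → δ x y ≤ suc (δ x' y))
  (geodesic : ∀ x y → Walk G x y (δ x y)) where

  δ≤length : ∀ {x y k} → Walk G x y k → δ x y ≤ k
  δ≤length {x} here                    = subst (_≤ 0) (sym (δ-refl x)) z≤n
  δ≤length {y = y} (step x~x' p) = ≤-trans (δ-edge y x~x') (s≤s (δ≤length p))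

  Dist-δ : ∀ x y → Dist G x y (δ x y)
  Dist-δ x y = geodesic x y , λ j j<δ p → <⇒≱ j<δ (δ≤length p)

  Dist⇒≡δ : ∀ x y k → Dist G x y k → k ≡ δ x y
  Dist⇒≡δ x y k (p , minimal) with δ x y <? k
  ... | yes δ<k = contradiction (geodesic x y) (minimal (δ x y) δ<k)
  ... | no δ≮k  = ≤-antisym (≮⇒≥ δ≮k) (δ≤length p)

  IsDiam-δ : ∀ {D} → (∀ x y → δ x y ≤ D) → (∃ λ x → ∃ λ y → δ x y ≡ D) → IsDiam G D
  IsDiam-δ {D} bound (x , y , δ≡D) =
    (x , y , subst (Dist G x y) δ≡D (Dist-δ x y)) , λ x' y' k d → subst (_≤ D) (sym (Dist⇒≡δ x' y' k d)) (bound x' y')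

  triangle : ∀ x y z → δ x z ≤ δ x y + δ y z
  triangle x y z = δ≤length (geodesic x y ++ᵂ geodesic y z)

  geodesic-step : ∀ {x y k} → δ x y ≡ suc k → ∃ λ x' → Adj G x x' × δ x' y ≡ k
  geodesic-step {x} {y} {k} δ≡ with subst (Walk G x y) δ≡ (geodesic x y)
  ... | step {v = x'} x~x' p =
    x' , x~x' , ≤-antisym (δ≤length p) (≤-pred (subst (_≤ suc (δ x' y)) δ≡ (δ-edge y x~x')))

  δ≡1⇒adjacent : ∀ {x y} → δ x y ≡ 1 → Adj G x y
  δ≡1⇒adjacent {x} {y} δ≡1 with subst (Walk G x y) δ≡1 (geodesic x y)
  ... | step x~y here = x~y

  δ-edgeʳ : ∀ {x y} z → Adj G x y → δ z y ≤ suc (δ z x)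
  δ-edgeʳ {x} {y} z x~y = subst₂ (λ p q → p ≤ suc q) (δ-sym z y) (δ-sym z x) (δ-edge z (adjacent-sym x~y))

  Between : V G → V G → V G → Set
  Between w x u = δ w x + δ x u ≡ δ w u

  between-predecessor : ∀ {w x u k} → δ w x ≡ suc k → Between w x u →
                        ∃ λ x' → Adj G x' x × δ w x' ≡ k × Between w x' u
  between-predecessor {w} {x} {u} {k} wx≡ between with geodesic-step (trans (δ-sym w x) wx≡)
  ... | x' , x~x' , x'w≡k = x' , adjacent-sym x~x' , wx'≡k , ≤-antisym upper (triangle w x' u)
    where
    wx'≡k : δ w x' ≡ k
    wx'≡k = trans (δ-sym x' w) x'w≡k
    upper : δ w x' + δ x' u ≤ δ w u
    upper = begin
      δ w x' + δ x' u       ≤⟨ +-mono-≤ (≤-reflexive wx'≡k) (δ-edge u (adjacent-sym x~x')) ⟩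
      k + suc (δ x u)       ≡⟨ +-suc k (δ x u) ⟩
      suc k + δ x u         ≡⟨ cong (_+ δ x u) wx≡ ⟨
      δ w x + δ x u         ≡⟨ between ⟩
      δ w u                 ∎
      where open ≤-Reasoning

  between-end : ∀ w u → Between w u u
  between-end w u = trans (cong (δ w u +_) (δ-refl u)) (+-identityʳ (δ w u))

  point-between : ∀ w u k → k ≤ δ w u → ∃ λ x → δ w x ≡ k × Between w x u
  point-between w u k k≤δ = points (δ w u ∸ k) k (m+[n∸m]≡n k≤δ)
    where
    points : ∀ i k → k + i ≡ δ w u → ∃ λ x → δ w x ≡ k × Between w x u
    points zero    k k+0≡δ = u , trans (sym k+0≡δ) (+-identityʳ k) , between-end w u
    points (suc i) k k+1+i≡δ with points i (suc k) (trans (sym (+-suc k i)) k+1+i≡δ)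
    ... | x , wx≡1+k , between with between-predecessor wx≡1+k between
    ...   | x' , _ , wx'≡k , between' = x' , wx'≡k , between'

  rainbow : ∀ {r} (c : V G → Fin r) x y z → δ x y ≡ δ y z →
            c x ≢ c y → c y ≢ c z → c x ≢ c z → HasRainbow3AP G c
  rainbow c x y z δ≡ xy yz xz =
    x , y , z , (δ x y , Dist-δ x y , subst (Dist G y z) (sym δ≡) (Dist-δ y z)) , xy , yz , xz

module Colourings (G : Graph) where

  SingletonClass : ∀ {r} → (V G → Fin r) → Fin r → Set
  SingletonClass c k = ∃ λ p → ∀ x → c x ≡ k → x ≡ p

  TwoSingletonClasses : ∀ {r} → (V G → Fin r) → Set
  TwoSingletonClasses c = ∃ λ k₁ → ∃ λ k₂ → k₁ ≢ k₂ × SingletonClass c k₁ × SingletonClass c k₂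

  ∘-surjective : ∀ {r s} {c : V G → Fin r} {f : Fin r → Fin s} →
                 Surjective c → Surjective f → Surjective (f ∘ c)
  ∘-surjective {c = c} {f} c-surj f-surj k with f-surj k
  ... | j , fj≡k with c-surj j
  ...   | x , cx≡j = x , trans (cong f cx≡j) fj≡k

  rainbow-of-merge : ∀ {r s} {c : V G → Fin r} (f : Fin r → Fin s) →
                     HasRainbow3AP G (f ∘ c) → HasRainbow3AP G c
  rainbow-of-merge f (x , y , z , ap , xy , yz , xz) =
    x , y , z , ap , xy ∘ cong f , yz ∘ cong f , xz ∘ cong f

  colour-change : ∀ {r} (c : V G → Fin r) {x y k} → Walk G x y k → c x ≢ c y →
                  ∃ λ p → ∃ λ q → Adj G p q × c p ≢ c q
  colour-change c here cx≢cx = contradiction refl cx≢cx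
  colour-change c {x} (step {v = x'} x~x' walk) cx≢cy with c x ≟ᶠ c x'
  ... | yes cx≡cx' = colour-change c walk (cx≢cy ∘ trans cx≡cx')
  ... | no cx≢cx'  = x , x' , x~x' , cx≢cx'

  no-rainbow-1 : V G → ¬ AllColoringsRainbow G 1
  no-rainbow-1 x all with all (λ _ → 0F) (λ { 0F → x , refl })
  ... | _ , _ , _ , _ , xy , _ = xy refl

  module _ (_≟V_ : DecidableEquality (V G)) where

    indicator : V G → V G → Fin 2
    indicator x₀ x with x ≟V x₀
    ... | yes _ = 0F
    ... | no _  = 1F

    no-rainbow-2 : ∀ {x₀ x₁} → x₁ ≢ x₀ → ¬ AllColoringsRainbow G 2
    no-rainbow-2 {x₀} {x₁} x₁≢x₀ all with all (indicator x₀) surjective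
      where
      surjective : Surjective (indicator x₀)
      surjective 0F = x₀ , helper
        where
        helper : indicator x₀ x₀ ≡ 0F
        helper with x₀ ≟V x₀
        ... | yes _   = refl
        ... | no x≢x = contradiction refl x≢x
      surjective 1F = x₁ , helper
        where
        helper : indicator x₀ x₁ ≡ 1F
        helper with x₁ ≟V x₀
        ... | yes x₁≡x₀ = contradiction x₁≡x₀ x₁≢x₀
        ... | no _      = refl
    ... | _ , _ , z , _ , xy , yz , xz with fin2-cases xy (indicator x₀ z)
    ...   | inj₁ z≡x = xz (sym z≡x)
    ...   | inj₂ z≡y = yz (sym z≡y)

  module _ {c : V G → Fin 4} (c-surj : Surjective c) (f : Fin 4 → Fin 3) where

    lift-singleton : ∀ j → SingletonClass (f ∘ c) (f j) → SingletonClass c j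
    lift-singleton j (p , unique) = p , λ x cx≡j → unique x (cong f cx≡j)

    merged-class-not-singleton : ∀ {k₀ k₁} → k₀ ≢ k₁ → f k₀ ≡ f k₁ → ¬ SingletonClass (f ∘ c) (f k₀)
    merged-class-not-singleton {k₀} {k₁} k₀≢k₁ fk₀≡fk₁ (p , unique) with c-surj k₀ | c-surj k₁
    ... | x₀ , cx₀≡k₀ | x₁ , cx₁≡k₁ =
      k₀≢k₁ (trans (sym cx₀≡k₀) (trans (cong c x₀≡x₁) cx₁≡k₁))
      where
      x₀≡x₁ : x₀ ≡ x₁
      x₀≡x₁ = trans (unique x₀ (cong f cx₀≡k₀))
                    (sym (unique x₁ (trans (cong f cx₁≡k₁) (sym fk₀≡fk₁))))

    singletons-of-merge : ∀ {k₀ k₁} → k₀ ≢ k₁ → f k₀ ≡ f k₁ → TwoSingletonClasses (f ∘ c) →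
                          ∀ j → f j ≢ f k₀ → SingletonClass c j
    singletons-of-merge {k₀} k₀≢k₁ merged (K₁ , K₂ , K₁≢K₂ , s₁ , s₂) j fj≢M
      with fin3-cases K₁≢K₂ K₂≢M K₁≢M (f j)
      where
      K₁≢M : K₁ ≢ f k₀
      K₁≢M K₁≡M = merged-class-not-singleton k₀≢k₁ merged (subst (SingletonClass (f ∘ c)) K₁≡M s₁)
      K₂≢M : K₂ ≢ f k₀
      K₂≢M K₂≡M = merged-class-not-singleton k₀≢k₁ merged (subst (SingletonClass (f ∘ c)) K₂≡M s₂)
    ... | inj₁ fj≡K₁        = lift-singleton j (subst (SingletonClass (f ∘ c)) (sym fj≡K₁) s₁)
    ... | inj₂ (inj₁ fj≡K₂) = lift-singleton j (subst (SingletonClass (f ∘ c)) (sym fj≡K₂) s₂)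
    ... | inj₂ (inj₂ fj≡M)  = contradiction fj≡M fj≢M

  merge01 merge23 : Fin 4 → Fin 3
  merge01 0F = 0F
  merge01 1F = 0F
  merge01 2F = 1F
  merge01 3F = 2F
  merge23 0F = 0F
  merge23 1F = 1F
  merge23 2F = 2F
  merge23 3F = 2F

  merge01-surjective : Surjective merge01
  merge01-surjective 0F = 0F , refl
  merge01-surjective 1F = 2F , refl
  merge01-surjective 2F = 3F , refl

  merge23-surjective : Surjective merge23
  merge23-surjective 0F = 0F , refl
  merge23-surjective 1F = 1F , refl
  merge23-surjective 2F = 2F , refl

  -- Merging two colours of a 4-colouring in two disjoint ways shows every colour class is a
  -- singleton, which is impossible on more than four vertices.
  four-colours-rainbow : (∀ (f : V G → Fin 4) → ¬ Injective _≡_ _≡_ f) →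
                         (∀ (c : V G → Fin 3) → Surjective c → HasRainbow3AP G c ⊎ TwoSingletonClasses c) →
                         AllColoringsRainbow G 4
  four-colours-rainbow large dichotomy c c-surj
    with dichotomy (merge01 ∘ c) (∘-surjective c-surj merge01-surjective)
       | dichotomy (merge23 ∘ c) (∘-surjective c-surj merge23-surjective)
  ... | inj₁ rb | _       = rainbow-of-merge merge01 rb
  ... | inj₂ _  | inj₁ rb = rainbow-of-merge merge23 rb
  ... | inj₂ t01 | inj₂ t23 = ⊥-elim (large c injective)
    where
    singleton : ∀ j → SingletonClass c j
    singleton 0F = singletons-of-merge c-surj merge23 {2F} {3F} (λ ()) refl t23 0F (λ ())
    singleton 1F = singletons-of-merge c-surj merge23 {2F} {3F} (λ ()) refl t23 1F (λ ())
    singleton 2F = singletons-of-merge c-surj merge01 {0F} {1F} (λ ()) refl t01 2F (λ ())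
    singleton 3F = singletons-of-merge c-surj merge01 {0F} {1F} (λ ()) refl t01 3F (λ ())
    injective : Injective _≡_ _≡_ c
    injective {x} {y} cx≡cy = trans (proj₂ (singleton (c x)) x refl) (sym (proj₂ (singleton (c x)) y (sym cx≡cy)))

-- The cycle

data Sign : Set where
  ⁺ ⁻ : Sign

flip : Sign → Sign
flip ⁺ = ⁻
flip ⁻ = ⁺

-- ℤ/m on Fin m. A backward walk a ⊕[ ⁻ ] k is a ⊕ (m ∸ k), so lemmas about it need k ≤ m.
module Cyclic (m : ℕ) (2≤m : 2 ≤ m) where

  1≤m : 1 ≤ m
  1≤m = ≤-trans (s≤s z≤n) 2≤m

  instance
    m-nonZero : NonZero m
    m-nonZero = >-nonZero 1≤m

  half : ℕ
  half = m / 2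

  half*2≡half+half : half * 2 ≡ half + half
  half*2≡half+half = trans (*-comm half 2) (cong (half +_) (+-identityʳ half))

  m≡m%2+[half+half] : m ≡ m % 2 + (half + half)
  m≡m%2+[half+half] = trans (m≡m%n+[m/n]*n m 2) (cong (m % 2 +_) half*2≡half+half)

  half+half≤m : half + half ≤ m
  half+half≤m = subst (half + half ≤_) (sym m≡m%2+[half+half]) (m≤n+m (half + half) (m % 2))

  m≤1+half+half : m ≤ suc (half + half)
  m≤1+half+half = subst (_≤ suc (half + half)) (sym m≡m%2+[half+half])
                        (+-monoˡ-≤ (half + half) (≤-pred (m%n<n m 2)))

  1≤half : 1 ≤ half
  1≤half = m≥n⇒m/n>0 2≤m

  half<m : half < m
  half<m = <-≤-trans (subst (_< half + half) (+-identityʳ half) (+-monoʳ-< half 1≤half)) half+half≤m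

  half≤m : half ≤ m
  half≤m = <⇒≤ half<m

  even⇒m≡half+half : 2 ∣ m → m ≡ half + half
  even⇒m≡half+half 2∣m = trans m≡m%2+[half+half] (cong (_+ (half + half)) (n∣m⇒m%n≡0 m 2 2∣m))

  odd⇒m≡1+half+half : ¬ 2 ∣ m → m ≡ suc (half + half)
  odd⇒m≡1+half+half 2∤m = trans m≡m%2+[half+half] (cong (_+ (half + half)) m%2≡1)
    where
    m%2≡1 : m % 2 ≡ 1
    m%2≡1 with m % 2 in eq | m%n<n m 2
    ... | 0           | _            = contradiction (m%n≡0⇒n∣m m 2 eq) 2∤m
    ... | 1           | _            = refl
    ... | suc (suc _) | s≤s (s≤s ())

  infixl 6 _⊕_ _⊕[_]_

  _⊕_ : Fin m → ℕ → Fin m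
  a ⊕ k = fromℕ< (m%n<n (toℕ a + k) m)

  toℕ-⊕ : ∀ a k → toℕ (a ⊕ k) ≡ (toℕ a + k) % m
  toℕ-⊕ a k = toℕ-fromℕ< _

  ⊕-assoc : ∀ a k l → a ⊕ k ⊕ l ≡ a ⊕ (k + l)
  ⊕-assoc a k l = toℕ-injective (begin
    toℕ (a ⊕ k ⊕ l)           ≡⟨ toℕ-⊕ (a ⊕ k) l ⟩
    (toℕ (a ⊕ k) + l) % m     ≡⟨ cong (λ x → (x + l) % m) (toℕ-⊕ a k) ⟩
    ((toℕ a + k) % m + l) % m ≡⟨ [m%d+n]%d≡[m+n]%d (toℕ a + k) l m ⟩
    (toℕ a + k + l) % m       ≡⟨ cong (_% m) (+-assoc (toℕ a) k l) ⟩
    (toℕ a + (k + l)) % m     ≡⟨ toℕ-⊕ a (k + l) ⟨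
    toℕ (a ⊕ (k + l))         ∎)
    where open ≡-Reasoning

  ⊕-comm : ∀ a k l → a ⊕ k ⊕ l ≡ a ⊕ l ⊕ k
  ⊕-comm a k l = trans (⊕-assoc a k l) (trans (cong (a ⊕_) (+-comm k l)) (sym (⊕-assoc a l k)))

  ⊕-+m : ∀ a k → a ⊕ (k + m) ≡ a ⊕ k
  ⊕-+m a k = toℕ-injective (begin
    toℕ (a ⊕ (k + m))         ≡⟨ toℕ-⊕ a (k + m) ⟩
    (toℕ a + (k + m)) % m     ≡⟨ cong (_% m) (+-assoc (toℕ a) k m) ⟨
    (toℕ a + k + m) % m       ≡⟨ [m+n]%n≡m%n (toℕ a + k) m ⟩
    (toℕ a + k) % m           ≡⟨ toℕ-⊕ a k ⟨
    toℕ (a ⊕ k)               ∎)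
    where open ≡-Reasoning

  ⊕-identityʳ : ∀ a → a ⊕ 0 ≡ a
  ⊕-identityʳ a = toℕ-injective (trans (toℕ-⊕ a 0)
                    (trans (cong (_% m) (+-identityʳ (toℕ a))) (m<n⇒m%n≡m (toℕ<n a))))

  ⊕-m : ∀ a → a ⊕ m ≡ a
  ⊕-m a = trans (⊕-+m a 0) (⊕-identityʳ a)

  offset : Fin m → Fin m → ℕ
  offset a b = (toℕ b + (m ∸ toℕ a)) % m

  offset<m : ∀ a b → offset a b < m
  offset<m a b = m%n<n _ m

  ⊕-offset : ∀ a b → a ⊕ offset a b ≡ b
  ⊕-offset a b = toℕ-injective (begin
    toℕ (a ⊕ offset a b)                ≡⟨ toℕ-⊕ a (offset a b) ⟩
    (toℕ a + offset a b) % m            ≡⟨ cong (_% m) (+-comm (toℕ a) (offset a b)) ⟩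
    (offset a b + toℕ a) % m            ≡⟨ [m%d+n]%d≡[m+n]%d (toℕ b + (m ∸ toℕ a)) (toℕ a) m ⟩
    (toℕ b + (m ∸ toℕ a) + toℕ a) % m   ≡⟨ cong (_% m) (+-assoc (toℕ b) (m ∸ toℕ a) (toℕ a)) ⟩
    (toℕ b + (m ∸ toℕ a + toℕ a)) % m   ≡⟨ cong (λ x → (toℕ b + x) % m) (m∸n+n≡m (<⇒≤ (toℕ<n a))) ⟩
    (toℕ b + m) % m                     ≡⟨ [m+n]%n≡m%n (toℕ b) m ⟩
    toℕ b % m                           ≡⟨ m<n⇒m%n≡m (toℕ<n b) ⟩
    toℕ b                               ∎)
    where open ≡-Reasoning

  offset-⊕ : ∀ a k → offset a (a ⊕ k) ≡ k % m
  offset-⊕ a k = begin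
    (toℕ (a ⊕ k) + (m ∸ toℕ a)) % m     ≡⟨ cong (λ x → (x + (m ∸ toℕ a)) % m) (toℕ-⊕ a k) ⟩
    ((toℕ a + k) % m + (m ∸ toℕ a)) % m ≡⟨ [m%d+n]%d≡[m+n]%d (toℕ a + k) (m ∸ toℕ a) m ⟩
    (toℕ a + k + (m ∸ toℕ a)) % m       ≡⟨ cong (_% m) (xy∙z≈y∙xz (toℕ a) k (m ∸ toℕ a)) ⟩
    (k + (toℕ a + (m ∸ toℕ a))) % m     ≡⟨ cong (λ x → (k + x) % m) (m+[n∸m]≡n (<⇒≤ (toℕ<n a))) ⟩
    (k + m) % m                         ≡⟨ [m+n]%n≡m%n k m ⟩
    k % m                               ∎
    where open ≡-Reasoning

  _⊕[_]_ : Fin m → Sign → ℕ → Fin m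
  a ⊕[ ⁺ ] k = a ⊕ k
  a ⊕[ ⁻ ] k = a ⊕ (m ∸ k)

  ⊕[]-identityʳ : ∀ a s → a ⊕[ s ] 0 ≡ a
  ⊕[]-identityʳ a ⁺ = ⊕-identityʳ a
  ⊕[]-identityʳ a ⁻ = ⊕-m a

  ⊕[]-cancel : ∀ a s {k} → k ≤ m → a ⊕[ s ] k ⊕[ flip s ] k ≡ a
  ⊕[]-cancel a ⁺ {k} k≤m = trans (⊕-assoc a k (m ∸ k)) (trans (cong (a ⊕_) (m+[n∸m]≡n k≤m)) (⊕-m a))
  ⊕[]-cancel a ⁻ {k} k≤m = trans (⊕-assoc a (m ∸ k) k) (trans (cong (a ⊕_) (m∸n+n≡m k≤m)) (⊕-m a))

  ⊕[]-assoc : ∀ a s {k l} → k + l ≤ m → a ⊕[ s ] k ⊕[ s ] l ≡ a ⊕[ s ] (k + l)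
  ⊕[]-assoc a ⁺ {k} {l} _   = ⊕-assoc a k l
  ⊕[]-assoc a ⁻ {k} {l} k+l≤m =
    trans (⊕-assoc a (m ∸ k) (m ∸ l)) (trans (cong (a ⊕_) ([n∸k]+[n∸l]≡[n∸[k+l]]+n {k} {l} k+l≤m)) (⊕-+m a (m ∸ (k + l))))

  shortest : ℕ → ℕ
  shortest f = f ⊓ (m ∸ f)

  shortest-small : ∀ {k} → k ≤ half → shortest k ≡ k
  shortest-small {k} k≤half = m≤n⇒m⊓n≡m (subst (_≤ m ∸ k) (m+n∸n≡m k k) (∸-monoˡ-≤ k k+k≤m))
    where
    k+k≤m : k + k ≤ m
    k+k≤m = ≤-trans (+-mono-≤ k≤half k≤half) half+half≤m

  shortest≤ : ∀ f → shortest f ≤ f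
  shortest≤ f = m⊓n≤m f (m ∸ f)

  complement-large : ∀ {f} → ¬ f ≤ half → m ∸ f ≤ half
  complement-large {f} f≰half = begin
    m ∸ f                         ≤⟨ ∸-monoˡ-≤ f m≤1+half+half ⟩
    suc (half + half) ∸ f         ≤⟨ ∸-monoʳ-≤ (suc (half + half)) (≰⇒> f≰half) ⟩
    suc (half + half) ∸ suc half  ≡⟨ m+n∸m≡n half half ⟩
    half                          ∎
    where open ≤-Reasoning

  shortest≤half : ∀ f → shortest f ≤ half
  shortest≤half f with f ≤? half
  ... | yes f≤half = ≤-trans (shortest≤ f) f≤half
  ... | no f≰half  = ≤-trans (m⊓n≤n f (m ∸ f)) (complement-large f≰half)

  shortest-complement : ∀ {f} → f ≤ m → shortest ((m ∸ f) % m) ≡ shortest f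
  shortest-complement {zero}  _     = cong shortest (n%n≡0 m)
  shortest-complement {suc f} 1+f≤m = begin
    shortest ((m ∸ suc f) % m)          ≡⟨ cong shortest (m<n⇒m%n≡m (∸-monoʳ-< z<s 1+f≤m)) ⟩
    (m ∸ suc f) ⊓ (m ∸ (m ∸ suc f))     ≡⟨ cong ((m ∸ suc f) ⊓_) (m∸[m∸n]≡n 1+f≤m) ⟩
    (m ∸ suc f) ⊓ suc f                 ≡⟨ ⊓-comm (m ∸ suc f) (suc f) ⟩
    shortest (suc f)                    ∎
    where open ≡-Reasoning

  cdist : Fin m → Fin m → ℕ
  cdist a b = shortest (offset a b)

  cdist≤half : ∀ a b → cdist a b ≤ half
  cdist≤half a b = shortest≤half (offset a b)

  cdist-⊕ : ∀ a k → cdist a (a ⊕ k) ≡ shortest (k % m)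
  cdist-⊕ a k = cong shortest (offset-⊕ a k)

  cdist-⊕[] : ∀ a s {k} → k ≤ half → cdist a (a ⊕[ s ] k) ≡ k
  cdist-⊕[] a ⁺ {k} k≤half =
    trans (cdist-⊕ a k) (trans (cong shortest (m<n⇒m%n≡m (≤-<-trans k≤half half<m))) (shortest-small k≤half))
  cdist-⊕[] a ⁻ {k} k≤half =
    trans (cdist-⊕ a (m ∸ k)) (trans (shortest-complement (≤-trans k≤half half≤m)) (shortest-small k≤half))

  cdist-⊕[]-≤ : ∀ a s {k} → k ≤ m → cdist a (a ⊕[ s ] k) ≤ k
  cdist-⊕[]-≤ a ⁺ {k} _   = ≤-trans (shortest≤ (offset a (a ⊕ k)))
                                     (subst (_≤ k) (sym (offset-⊕ a k)) (m%n≤m k m))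
  cdist-⊕[]-≤ a ⁻ {k} k≤m = subst (_≤ k) (sym (trans (cdist-⊕ a (m ∸ k)) (shortest-complement k≤m))) (shortest≤ k)

  cdist-refl : ∀ a → cdist a a ≡ 0
  cdist-refl a = subst (λ b → cdist a b ≡ 0) (⊕-identityʳ a) (cdist-⊕[] a ⁺ z≤n)

  cdist-sym : ∀ a b → cdist b a ≡ cdist a b
  cdist-sym a b = begin
    cdist b a                          ≡⟨ cong (cdist b) a≡b⊕[m∸f] ⟩
    cdist b (b ⊕ (m ∸ f))              ≡⟨ cdist-⊕ b (m ∸ f) ⟩
    shortest ((m ∸ f) % m)             ≡⟨ shortest-complement (<⇒≤ (offset<m a b)) ⟩
    cdist a b                          ∎
    where
    open ≡-Reasoning
    f = offset a b
    a≡b⊕[m∸f] : a ≡ b ⊕ (m ∸ f)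
    a≡b⊕[m∸f] = trans (sym (⊕[]-cancel a ⁺ (<⇒≤ (offset<m a b)))) (cong (_⊕ (m ∸ f)) (⊕-offset a b))

  cdist-translate : ∀ a b k → cdist (a ⊕ k) (b ⊕ k) ≡ cdist a b
  cdist-translate a b k = begin
    cdist (a ⊕ k) (b ⊕ k)          ≡⟨ cong (λ x → cdist (a ⊕ k) (x ⊕ k)) (⊕-offset a b) ⟨
    cdist (a ⊕ k) (a ⊕ f ⊕ k)      ≡⟨ cong (cdist (a ⊕ k)) (⊕-comm a f k) ⟩
    cdist (a ⊕ k) (a ⊕ k ⊕ f)      ≡⟨ cdist-⊕ (a ⊕ k) f ⟩
    shortest (f % m)               ≡⟨ cong shortest (m<n⇒m%n≡m (offset<m a b)) ⟩
    cdist a b                      ∎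
    where
    open ≡-Reasoning
    f = offset a b

  cdist-translate[] : ∀ a b s k → cdist (a ⊕[ s ] k) (b ⊕[ s ] k) ≡ cdist a b
  cdist-translate[] a b ⁺ k = cdist-translate a b k
  cdist-translate[] a b ⁻ k = cdist-translate a b (m ∸ k)

  cdist-view : ∀ a b → ∃ λ s → b ≡ a ⊕[ s ] cdist a b
  cdist-view a b with offset a b ≤? half
  ... | yes f≤half = ⁺ , trans (sym (⊕-offset a b)) (cong (a ⊕_) (sym (shortest-small f≤half)))
  ... | no f≰half  = ⁻ , trans (sym (⊕-offset a b)) (cong (a ⊕_) f≡m∸shortest)
    where
    f = offset a b
    f≡m∸shortest : f ≡ m ∸ shortest f
    f≡m∸shortest = begin
      f               ≡⟨ m∸[m∸n]≡n (<⇒≤ (offset<m a b)) ⟨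
      m ∸ (m ∸ f)     ≡⟨ cong (m ∸_) (m≥n⇒m⊓n≡n (≤-trans (complement-large f≰half) (<⇒≤ (≰⇒> f≰half)))) ⟨
      m ∸ shortest f  ∎
      where open ≡-Reasoning

  cdist≡0⇒≡ : ∀ {a b} → cdist a b ≡ 0 → a ≡ b
  cdist≡0⇒≡ {a} {b} cdist≡0 with cdist-view a b
  ... | s , b≡ = sym (trans b≡ (trans (cong (a ⊕[ s ]_) cdist≡0) (⊕[]-identityʳ a s)))

  ⊕[flip]-cancel : ∀ a s {k} → k ≤ m → a ⊕[ flip s ] k ⊕[ s ] k ≡ a
  ⊕[flip]-cancel a ⁺ = ⊕[]-cancel a ⁻
  ⊕[flip]-cancel a ⁻ = ⊕[]-cancel a ⁺

  ⊕[]-split : ∀ a s {k l} → k ≤ l → l ≤ m → a ⊕[ s ] l ≡ a ⊕[ s ] k ⊕[ s ] (l ∸ k)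
  ⊕[]-split a s {k} {l} k≤l l≤m =
    trans (cong (a ⊕[ s ]_) (sym (m+[n∸m]≡n k≤l))) (sym (⊕[]-assoc a s (subst (_≤ m) (sym (m+[n∸m]≡n k≤l)) l≤m)))

  cdist-between : ∀ a s {k l} → k ≤ l → l ≤ m → l ∸ k ≤ half → cdist (a ⊕[ s ] k) (a ⊕[ s ] l) ≡ l ∸ k
  cdist-between a s {k} k≤l l≤m l∸k≤half =
    trans (cong (cdist (a ⊕[ s ] k)) (⊕[]-split a s k≤l l≤m)) (cdist-⊕[] (a ⊕[ s ] k) s l∸k≤half)

  cdist-⊕[]ˡ : ∀ a s {k} → k ≤ half → cdist (a ⊕[ s ] k) a ≡ k
  cdist-⊕[]ˡ a s k≤half = trans (cdist-sym a (a ⊕[ s ] _)) (cdist-⊕[] a s k≤half)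

  ⊕[]-comm-⊕ : ∀ a s k l → a ⊕[ s ] k ⊕ l ≡ a ⊕ l ⊕[ s ] k
  ⊕[]-comm-⊕ a ⁺ k l = ⊕-comm a k l
  ⊕[]-comm-⊕ a ⁻ k l = ⊕-comm a (m ∸ k) l

  cdist-across : ∀ a s {j k} → j + k ≤ half → cdist (a ⊕[ flip s ] j) (a ⊕[ s ] k) ≡ j + k
  cdist-across a s {j} {k} j+k≤half = begin
    cdist b (a ⊕[ s ] k)                 ≡⟨ cong (λ x → cdist b (x ⊕[ s ] k)) (⊕[flip]-cancel a s j≤m) ⟨
    cdist b (b ⊕[ s ] j ⊕[ s ] k)        ≡⟨ cong (cdist b) (⊕[]-assoc b s (≤-trans j+k≤half half≤m)) ⟩
    cdist b (b ⊕[ s ] (j + k))           ≡⟨ cdist-⊕[] b s j+k≤half ⟩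
    j + k                                ∎
    where
    open ≡-Reasoning
    b = a ⊕[ flip s ] j
    j≤m : j ≤ m
    j≤m = ≤-trans (m≤m+n j k) (≤-trans j+k≤half half≤m)

  cdist-onward : ∀ a s {k} → k < m → cdist a (a ⊕[ s ] k ⊕[ s ] 1) ≤ suc k
  cdist-onward a s {k} k<m =
    subst (λ x → cdist a x ≤ suc k) (sym (⊕[]-assoc a s k+1≤m))
          (subst (cdist a (a ⊕[ s ] (k + 1)) ≤_) (+-comm k 1) (cdist-⊕[]-≤ a s k+1≤m))
    where
    k+1≤m : k + 1 ≤ m
    k+1≤m = subst (_≤ m) (+-comm 1 k) k<m

  cdist-back : ∀ a s {k} → k < m → cdist a (a ⊕[ s ] k ⊕[ flip s ] 1) ≤ suc k
  cdist-back a s {zero} _ =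
    subst (λ x → cdist a (x ⊕[ flip s ] 1) ≤ 1) (sym (⊕[]-identityʳ a s)) (cdist-⊕[]-≤ a (flip s) 1≤m)
  cdist-back a s {suc j} 1+j<m =
    subst (λ x → cdist a x ≤ suc (suc j)) (sym one-step-back)
          (≤-trans (cdist-⊕[]-≤ a s (<⇒≤ (≤-trans (n≤1+n (suc j)) 1+j<m))) (≤-trans (n≤1+n j) (n≤1+n (suc j))))
    where
    one-step-back : a ⊕[ s ] suc j ⊕[ flip s ] 1 ≡ a ⊕[ s ] j
    one-step-back = begin
      a ⊕[ s ] suc j ⊕[ flip s ] 1         ≡⟨ cong (λ x → a ⊕[ s ] x ⊕[ flip s ] 1) (+-comm 1 j) ⟩
      a ⊕[ s ] (j + 1) ⊕[ flip s ] 1       ≡⟨ cong (_⊕[ flip s ] 1) (⊕[]-assoc a s (subst (_≤ m) (+-comm 1 j) (<⇒≤ 1+j<m))) ⟨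
      a ⊕[ s ] j ⊕[ s ] 1 ⊕[ flip s ] 1    ≡⟨ ⊕[]-cancel (a ⊕[ s ] j) s 1≤m ⟩
      a ⊕[ s ] j                           ∎
      where open ≡-Reasoning

  cdist-step : ∀ a b s → cdist a (b ⊕[ s ] 1) ≤ suc (cdist a b)
  cdist-step a b s with cdist-view a b
  ... | σ , b≡ = subst (λ x → cdist a (x ⊕[ s ] 1) ≤ suc (cdist a b)) (sym b≡) (by-sign σ s)
    where
    k<m : cdist a b < m
    k<m = ≤-<-trans (cdist≤half a b) half<m
    by-sign : ∀ σ s → cdist a (a ⊕[ σ ] cdist a b ⊕[ s ] 1) ≤ suc (cdist a b)
    by-sign ⁺ ⁺ = cdist-onward a ⁺ k<m
    by-sign ⁻ ⁻ = cdist-onward a ⁻ k<m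
    by-sign ⁺ ⁻ = cdist-back a ⁺ k<m
    by-sign ⁻ ⁺ = cdist-back a ⁻ k<m

  succ⇒⊕1 : ∀ {a b} → CycSucc m a b → b ≡ a ⊕ 1
  succ⇒⊕1 {a} {b} (inj₁ b≡1+a) = toℕ-injective (trans b≡1+a (sym (trans (toℕ-⊕ a 1)
    (trans (cong (_% m) (+-comm (toℕ a) 1)) (m<n⇒m%n≡m (subst (_< m) b≡1+a (toℕ<n b)))))))
  succ⇒⊕1 {a} {b} (inj₂ (1+a≡m , b≡0)) = toℕ-injective (trans b≡0 (sym (trans (toℕ-⊕ a 1)
    (trans (cong (_% m) (trans (+-comm (toℕ a) 1) 1+a≡m)) (n%n≡0 m)))))

  ⊕1-succ : ∀ a → CycSucc m a (a ⊕ 1)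
  ⊕1-succ a with suc (toℕ a) <? m
  ... | yes 1+a<m  = inj₁ (trans (toℕ-⊕ a 1) (trans (cong (_% m) (+-comm (toℕ a) 1)) (m<n⇒m%n≡m 1+a<m)))
  ... | no 1+a≮m   = inj₂ (1+a≡m , trans (toℕ-⊕ a 1) (trans (cong (_% m) (trans (+-comm (toℕ a) 1) 1+a≡m)) (n%n≡0 m)))
    where
    1+a≡m : suc (toℕ a) ≡ m
    1+a≡m = ≤-antisym (toℕ<n a) (≮⇒≥ 1+a≮m)

  adjacent⇒step : ∀ {a b} → Adj (Cycle m) a b → ∃ λ s → b ≡ a ⊕[ s ] 1
  adjacent⇒step (inj₁ a→b)       = ⁺ , succ⇒⊕1 a→b
  adjacent⇒step {a} {b} (inj₂ b→a) =
    ⁻ , trans (sym (⊕[]-cancel b ⁺ 1≤m)) (cong (_⊕[ ⁻ ] 1) (sym (succ⇒⊕1 b→a)))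

  step-adjacent : ∀ a s → Adj (Cycle m) a (a ⊕[ s ] 1)
  step-adjacent a ⁺ = inj₁ (⊕1-succ a)
  step-adjacent a ⁻ = inj₂ (subst (CycSucc m (a ⊕[ ⁻ ] 1)) (⊕[]-cancel a ⁻ 1≤m) (⊕1-succ (a ⊕[ ⁻ ] 1)))

  module Even (2∣m : 2 ∣ m) where

    m≡half+half : m ≡ half + half
    m≡half+half = even⇒m≡half+half 2∣m

    ⊕[]-half : ∀ a s → a ⊕[ s ] half ≡ a ⊕ half
    ⊕[]-half a ⁺ = refl
    ⊕[]-half a ⁻ = cong (a ⊕_) (trans (cong (_∸ half) m≡half+half) (m+n∸m≡n half half))

    antipode-involutive : ∀ a → a ⊕ half ⊕ half ≡ a
    antipode-involutive a = trans (⊕-assoc a half half) (trans (cong (a ⊕_) (sym m≡half+half)) (⊕-m a))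

    antipode-unique : ∀ {a b} → cdist a b ≡ half → b ≡ a ⊕ half
    antipode-unique {a} {b} cdist≡half with cdist-view a b
    ... | s , b≡ = trans b≡ (trans (cong (a ⊕[ s ]_) cdist≡half) (⊕[]-half a s))

    antipode-sum : ∀ a b → cdist a b + cdist b (a ⊕ half) ≡ half
    antipode-sum a b with cdist-view a b
    ... | s , b≡ = begin
      k + cdist b (a ⊕ half)                   ≡⟨ cong₂ (λ x y → k + cdist x y) b≡ (sym (⊕[]-half a s)) ⟩
      k + cdist (a ⊕[ s ] k) (a ⊕[ s ] half)   ≡⟨ cong (k +_) (cdist-between a s (cdist≤half a b) half≤m (m∸n≤m half k)) ⟩
      k + (half ∸ k)                           ≡⟨ m+[n∸m]≡n (cdist≤half a b) ⟩
      half                                     ∎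
      where
      open ≡-Reasoning
      k = cdist a b

  module Odd (2∤m : ¬ 2 ∣ m) where

    m≡1+half+half : m ≡ suc (half + half)
    m≡1+half+half = odd⇒m≡1+half+half 2∤m

    m≡half+[half+1] : m ≡ half + (half + 1)
    m≡half+[half+1] = trans m≡1+half+half (shuffle half)
      where
      shuffle : ∀ h → suc (h + h) ≡ h + (h + 1)
      shuffle = solve-∀

    ⊕[]-past-half : ∀ a s → a ⊕[ s ] half ⊕[ s ] 1 ≡ a ⊕[ flip s ] half
    ⊕[]-past-half a s = trans (⊕[]-assoc a s half+1≤m) (past s)
      where
      half+1≤m : half + 1 ≤ m
      half+1≤m = subst (half + 1 ≤_) (sym m≡half+[half+1]) (m≤n+m (half + 1) half)
      past : ∀ s → a ⊕[ s ] (half + 1) ≡ a ⊕[ flip s ] half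
      past ⁺ = cong (a ⊕_) (sym (trans (cong (_∸ half) m≡half+[half+1]) (m+n∸m≡n half (half + 1))))
      past ⁻ = cong (a ⊕_) (trans (cong (_∸ (half + 1)) (trans m≡half+[half+1] (+-comm half (half + 1))))
                                  (m+n∸m≡n (half + 1) half))

    -- On an odd cycle the two points farthest from a, a ⊕[ ⁺ ] half and a ⊕[ ⁻ ] half, are adjacent.
    antipode-neighbour : ∀ {a b} → cdist a b ≡ half →
                         ∃ λ s → cdist a (b ⊕[ s ] 1) ≡ half × cdist (a ⊕[ s ] 1) b ≡ half ∸ 1
    antipode-neighbour {a} {b} cdist≡half with cdist-view a b
    ... | s , b≡ = s , far , near
      where
      b≡a⊕[s]half : b ≡ a ⊕[ s ] half
      b≡a⊕[s]half = trans b≡ (cong (a ⊕[ s ]_) cdist≡half)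
      far : cdist a (b ⊕[ s ] 1) ≡ half
      far = trans (cong (λ x → cdist a (x ⊕[ s ] 1)) b≡a⊕[s]half)
                  (trans (cong (cdist a) (⊕[]-past-half a s)) (cdist-⊕[] a (flip s) ≤-refl))
      near : cdist (a ⊕[ s ] 1) b ≡ half ∸ 1
      near = trans (cong (cdist (a ⊕[ s ] 1)) b≡a⊕[s]half) (cdist-between a s 1≤half half≤m (m∸n≤m half 1))

-- The torus

data Axis : Set where
  horizontal vertical : Axis

Dir : Set
Dir = Axis × Sign

opp : Dir → Dir
opp d = proj₁ d , flip (proj₂ d)

opp-involutive : ∀ d → opp (opp d) ≡ d
opp-involutive (_ , ⁺) = refl
opp-involutive (_ , ⁻) = refl

Perp : Dir → Dir → Set
Perp e f = proj₁ e ≢ proj₁ f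

perpendicular : Dir → Dir
perpendicular (horizontal , _) = vertical , ⁺
perpendicular (vertical , _)   = horizontal , ⁺

perpendicular-Perp : ∀ e → Perp e (perpendicular e)
perpendicular-Perp (horizontal , _) ()
perpendicular-Perp (vertical , _)   ()

sign-cases : ∀ s t → t ≡ s ⊎ t ≡ flip s
sign-cases ⁺ ⁺ = inj₁ refl
sign-cases ⁺ ⁻ = inj₂ refl
sign-cases ⁻ ⁺ = inj₂ refl
sign-cases ⁻ ⁻ = inj₁ refl

dir-cases : ∀ e g → g ≡ e ⊎ g ≡ opp e ⊎ Perp g e
dir-cases (horizontal , s) (vertical , t)   = inj₂ (inj₂ λ ())
dir-cases (vertical , s)   (horizontal , t) = inj₂ (inj₂ λ ())
dir-cases (horizontal , s) (horizontal , t) with sign-cases s t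
... | inj₁ refl = inj₁ refl
... | inj₂ refl = inj₂ (inj₁ refl)
dir-cases (vertical , s)   (vertical , t) with sign-cases s t
... | inj₁ refl = inj₁ refl
... | inj₂ refl = inj₂ (inj₁ refl)

module Torus (m n : ℕ) (2≤m : 2 ≤ m) (2≤n : 2 ≤ n) where

  module Cm = Cyclic m 2≤m
  module Cn = Cyclic n 2≤n
  open Cm using (_⊕_; _⊕[_]_)
  open Cn using () renaming (_⊕_ to _⊕′_; _⊕[_]_ to _⊕′[_]_)

  G : Graph
  G = Cycle m □ Cycle n

  Vertex : Set
  Vertex = Fin m × Fin n

  move : Dir → Vertex → Vertex
  move (horizontal , s) (a , b) = a ⊕[ s ] 1 , b
  move (vertical , s)   (a , b) = a , b ⊕′[ s ] 1

  dist : Vertex → Vertex → ℕ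
  dist (a , b) (a' , b') = Cm.cdist a a' + Cn.cdist b b'

  diameter : ℕ
  diameter = Cm.half + Cn.half

  halfOf : Axis → ℕ
  halfOf horizontal = Cm.half
  halfOf vertical   = Cn.half

  move-opp : ∀ d x → move (opp d) (move d x) ≡ x
  move-opp (horizontal , s) (a , b) = cong (_, b) (Cm.⊕[]-cancel a s Cm.1≤m)
  move-opp (vertical , s)   (a , b) = cong (a ,_) (Cn.⊕[]-cancel b s Cn.1≤m)

  move-adjacent : ∀ d x → Adj G x (move d x)
  move-adjacent (horizontal , s) (a , b) = inj₂ (refl , Cm.step-adjacent a s)
  move-adjacent (vertical , s)   (a , b) = inj₁ (refl , Cn.step-adjacent b s)

  adjacent⇒move : ∀ {x y} → Adj G x y → ∃ λ d → y ≡ move d x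
  adjacent⇒move (inj₁ (refl , b~b')) with Cn.adjacent⇒step b~b'
  ... | s , refl = (vertical , s) , refl
  adjacent⇒move (inj₂ (refl , a~a')) with Cm.adjacent⇒step a~a'
  ... | s , refl = (horizontal , s) , refl

  adjacent-sym : ∀ {x y} → Adj G x y → Adj G y x
  adjacent-sym {x} x~y with adjacent⇒move x~y
  ... | d , refl = subst (Adj G (move d x)) (move-opp d x) (move-adjacent (opp d) (move d x))

  dist-sym : ∀ x y → dist y x ≡ dist x y
  dist-sym (a , b) (a' , b') = cong₂ _+_ (Cm.cdist-sym a a') (Cn.cdist-sym b b')

  dist-refl : ∀ x → dist x x ≡ 0
  dist-refl (a , b) = cong₂ _+_ (Cm.cdist-refl a) (Cn.cdist-refl b)

  dist≡0⇒≡ : ∀ {x y} → dist x y ≡ 0 → x ≡ y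
  dist≡0⇒≡ {a , b} {a' , b'} dist≡0 =
    cong₂ _,_ (Cm.cdist≡0⇒≡ (m+n≡0⇒m≡0 _ dist≡0)) (Cn.cdist≡0⇒≡ (m+n≡0⇒n≡0 (Cm.cdist a a') dist≡0))

  dist≤diameter : ∀ x y → dist x y ≤ diameter
  dist≤diameter (a , b) (a' , b') = +-mono-≤ (Cm.cdist≤half a a') (Cn.cdist≤half b b')

  dist-move-≤ : ∀ x y d → dist x (move d y) ≤ suc (dist x y)
  dist-move-≤ (a , b) (a' , b') (horizontal , s) = +-monoˡ-≤ (Cn.cdist b b') (Cm.cdist-step a a' s)
  dist-move-≤ (a , b) (a' , b') (vertical , s)   =
    subst (Cm.cdist a a' + Cn.cdist b (b' ⊕′[ s ] 1) ≤_) (+-suc (Cm.cdist a a') (Cn.cdist b b'))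
          (+-monoʳ-≤ (Cm.cdist a a') (Cn.cdist-step b b' s))

  dist-edge : ∀ {x x'} y → Adj G x x' → dist x y ≤ suc (dist x' y)
  dist-edge {x} {x'} y x~x' with adjacent⇒move (adjacent-sym x~x')
  ... | d , refl = subst₂ (λ p q → p ≤ suc q) (dist-sym x y) (dist-sym x' y) (dist-move-≤ y x' d)

  march : Dir → ℕ → Vertex → Vertex
  march d zero    x = x
  march d (suc k) x = march d k (move d x)

  march-walk : ∀ d k x → Walk G x (march d k x) k
  march-walk d zero    x = here
  march-walk d (suc k) x = step (move-adjacent d x) (march-walk d k (move d x))

  march-horizontal : ∀ s {k} a b → k ≤ m → march (horizontal , s) k (a , b) ≡ (a ⊕[ s ] k , b)
  march-horizontal s {zero}  a b _     = cong (_, b) (sym (Cm.⊕[]-identityʳ a s))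
  march-horizontal s {suc k} a b 1+k≤m =
    trans (march-horizontal s (a ⊕[ s ] 1) b (≤-trans (n≤1+n k) 1+k≤m)) (cong (_, b) (Cm.⊕[]-assoc a s 1+k≤m))

  march-vertical : ∀ s {k} a b → k ≤ n → march (vertical , s) k (a , b) ≡ (a , b ⊕′[ s ] k)
  march-vertical s {zero}  a b _     = cong (a ,_) (sym (Cn.⊕[]-identityʳ b s))
  march-vertical s {suc k} a b 1+k≤n =
    trans (march-vertical s a (b ⊕′[ s ] 1) (≤-trans (n≤1+n k) 1+k≤n)) (cong (a ,_) (Cn.⊕[]-assoc b s 1+k≤n))

  geodesic : ∀ x y → Walk G x y (dist x y)
  geodesic (a , b) (a' , b') = horizontal-part ++ᵂ vertical-part
    where
    horizontal-part : Walk G (a , b) (a' , b) (Cm.cdist a a')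
    horizontal-part with Cm.cdist-view a a'
    ... | s , a'≡ = subst (λ z → Walk G (a , b) z (Cm.cdist a a'))
                          (trans (march-horizontal s a b (≤-trans (Cm.cdist≤half a a') Cm.half≤m)) (cong (_, b) (sym a'≡)))
                          (march-walk (horizontal , s) (Cm.cdist a a') (a , b))
    vertical-part : Walk G (a' , b) (a' , b') (Cn.cdist b b')
    vertical-part with Cn.cdist-view b b'
    ... | t , b'≡ = subst (λ z → Walk G (a' , b) z (Cn.cdist b b'))
                          (trans (march-vertical t a' b (≤-trans (Cn.cdist≤half b b') Cn.half≤m)) (cong (a' ,_) (sym b'≡)))
                          (march-walk (vertical , t) (Cn.cdist b b') (a' , b))

  open GraphDistance G dist dist-refl dist-sym adjacent-sym dist-edge geodesic public

  dist-move≡1 : ∀ d x → dist x (move d x) ≡ 1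
  dist-move≡1 (horizontal , s) (a , b) = cong₂ _+_ (Cm.cdist-⊕[] a s Cm.1≤half) (Cn.cdist-refl b)
  dist-move≡1 (vertical , s)   (a , b) = cong₂ _+_ (Cm.cdist-refl a) (Cn.cdist-⊕[] b s Cn.1≤half)

  dist-translate : ∀ d x y → dist (move d x) (move d y) ≡ dist x y
  dist-translate (horizontal , s) (a , b) (a' , b') = cong (_+ Cn.cdist b b') (Cm.cdist-translate[] a a' s 1)
  dist-translate (vertical , s)   (a , b) (a' , b') = cong (Cm.cdist a a' +_) (Cn.cdist-translate[] b b' s 1)

  dist-move-move≡2 : ∀ {f g} → Perp f g → ∀ x → dist x (move f (move g x)) ≡ 2
  dist-move-move≡2 {horizontal , s} {horizontal , t} f⊥g = contradiction refl f⊥g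
  dist-move-move≡2 {vertical , s}   {vertical , t}   f⊥g = contradiction refl f⊥g
  dist-move-move≡2 {horizontal , s} {vertical , t}   _ (a , b) =
    cong₂ _+_ (Cm.cdist-⊕[] a s Cm.1≤half) (Cn.cdist-⊕[] b t Cn.1≤half)
  dist-move-move≡2 {vertical , s}   {horizontal , t} _ (a , b) =
    cong₂ _+_ (Cm.cdist-⊕[] a t Cm.1≤half) (Cn.cdist-⊕[] b s Cn.1≤half)

  1≤halfOf : ∀ x → 1 ≤ halfOf x
  1≤halfOf horizontal = Cm.1≤half
  1≤halfOf vertical   = Cn.1≤half

  halfOf-Perp : ∀ {e f} → Perp e f → halfOf (proj₁ e) + halfOf (proj₁ f) ≡ diameter
  halfOf-Perp {horizontal , _} {horizontal , _} e⊥f = contradiction refl e⊥f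
  halfOf-Perp {horizontal , _} {vertical , _}   _   = refl
  halfOf-Perp {vertical , _}   {horizontal , _} _   = +-comm Cn.half Cm.half
  halfOf-Perp {vertical , _}   {vertical , _}   e⊥f = contradiction refl e⊥f

  -- z is u moved s steps against e and t steps against f.
  corner-point : ∀ u e f → Perp e f → ∀ {s t} → s < halfOf (proj₁ e) → t < halfOf (proj₁ f) →
                 ∃ λ z → dist z u ≡ s + t × dist z (move e u) ≡ suc (s + t) × dist z (move f u) ≡ suc (s + t)
  corner-point u (horizontal , _) (horizontal , _) e⊥f = contradiction refl e⊥f
  corner-point u (vertical , _)   (vertical , _)   e⊥f = contradiction refl e⊥f
  corner-point (a , b) (horizontal , σ) (vertical , τ) _ {s} {t} s<h t<h =
    (a ⊕[ flip σ ] s , b ⊕′[ flip τ ] t)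
    , cong₂ _+_ (Cm.cdist-⊕[]ˡ a (flip σ) (<⇒≤ s<h)) (Cn.cdist-⊕[]ˡ b (flip τ) (<⇒≤ t<h))
    , cong₂ _+_ (trans (Cm.cdist-across a σ (subst (_≤ Cm.half) (+-comm 1 s) s<h)) (+-comm s 1))
                (Cn.cdist-⊕[]ˡ b (flip τ) (<⇒≤ t<h))
    , trans (cong₂ _+_ (Cm.cdist-⊕[]ˡ a (flip σ) (<⇒≤ s<h))
                       (Cn.cdist-across b τ (subst (_≤ Cn.half) (+-comm 1 t) t<h)))
            (trans (cong (s +_) (+-comm t 1)) (+-suc s t))
  corner-point (a , b) (vertical , σ) (horizontal , τ) _ {s} {t} s<h t<h =
    (a ⊕[ flip τ ] t , b ⊕′[ flip σ ] s)
    , trans (cong₂ _+_ (Cm.cdist-⊕[]ˡ a (flip τ) (<⇒≤ t<h)) (Cn.cdist-⊕[]ˡ b (flip σ) (<⇒≤ s<h))) (+-comm t s)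
    , trans (cong₂ _+_ (Cm.cdist-⊕[]ˡ a (flip τ) (<⇒≤ t<h))
                       (Cn.cdist-across b σ (subst (_≤ Cn.half) (+-comm 1 s) s<h)))
            (trans (cong (t +_) (+-comm s 1)) (trans (+-suc t s) (cong suc (+-comm t s))))
    , trans (cong₂ _+_ (Cm.cdist-across a τ (subst (_≤ Cm.half) (+-comm 1 t) t<h))
                       (Cn.cdist-⊕[]ˡ b (flip σ) (<⇒≤ s<h)))
            (trans (cong (_+ s) (+-comm t 1)) (cong suc (+-comm t s)))

  corner : ∀ u e f → Perp e f → ∀ a → a + 2 ≤ diameter →
           ∃ λ z → dist z u ≡ a × dist z (move e u) ≡ suc a × dist z (move f u) ≡ suc a
  corner u e f e⊥f a a+2≤diameter
    with split-below a (1≤halfOf (proj₁ e)) (1≤halfOf (proj₁ f)) (subst (a + 2 ≤_) (sym (halfOf-Perp {e} {f} e⊥f)) a+2≤diameter)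
  ... | s , t , refl , s<h , t<h = corner-point u e f e⊥f s<h t<h

  diameter-split : ∀ {a b a' b'} → dist (a , b) (a' , b') ≡ diameter →
                   Cm.cdist a a' ≡ Cm.half × Cn.cdist b b' ≡ Cn.half
  diameter-split {a} {b} {a'} {b'} sum≡ = first , second
    where
    first : Cm.cdist a a' ≡ Cm.half
    first = ≤-antisym (Cm.cdist≤half a a')
              (+-cancelʳ-≤ (Cn.cdist b b') _ _ (subst (Cm.half + Cn.cdist b b' ≤_) (sym sum≡)
                                               (+-monoʳ-≤ Cm.half (Cn.cdist≤half b b'))))
    second : Cn.cdist b b' ≡ Cn.half
    second = +-cancelˡ-≡ Cm.half _ _ (trans (cong (_+ Cn.cdist b b') (sym first)) sum≡)

  diameter-attained : ∀ x → ∃ λ y → dist x y ≡ diameter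
  diameter-attained (a , b) = (a ⊕ Cm.half , b ⊕′ Cn.half) , cong₂ _+_ (Cm.cdist-⊕[] a ⁺ ≤-refl) (Cn.cdist-⊕[] b ⁺ ≤-refl)

  module Antipodes (2∣m : 2 ∣ m) (2∣n : 2 ∣ n) where

    module Em = Cm.Even 2∣m
    module En = Cn.Even 2∣n

    antipode : Vertex → Vertex
    antipode (a , b) = a ⊕ Cm.half , b ⊕′ Cn.half

    antipode-sum : ∀ x y → dist x y + dist y (antipode x) ≡ diameter
    antipode-sum (a , b) (a' , b') =
      trans (interchange (Cm.cdist a a') (Cn.cdist b b') (Cm.cdist a' (a ⊕ Cm.half)) (Cn.cdist b' (b ⊕′ Cn.half)))
            (cong₂ _+_ (Em.antipode-sum a a') (En.antipode-sum b b'))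

    antipode-unique : ∀ {x y} → dist x y ≡ diameter → y ≡ antipode x
    antipode-unique {a , b} d≡ with diameter-split {a} {b} d≡
    ... | ca≡ , cb≡ = cong₂ _,_ (Em.antipode-unique ca≡) (En.antipode-unique cb≡)

    dist-antipode : ∀ x → dist x (antipode x) ≡ diameter
    dist-antipode (a , b) = cong₂ _+_ (Cm.cdist-⊕[] a ⁺ ≤-refl) (Cn.cdist-⊕[] b ⁺ ≤-refl)

    antipode-move : ∀ d x → antipode (move d x) ≡ move d (antipode x)
    antipode-move (horizontal , s) (a , b) = cong (_, b ⊕′ Cn.half) (Cm.⊕[]-comm-⊕ a s 1 Cm.half)
    antipode-move (vertical , s)   (a , b) = cong (a ⊕ Cm.half ,_) (Cn.⊕[]-comm-⊕ b s 1 Cn.half)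

    antipode-involutive : ∀ x → antipode (antipode x) ≡ x
    antipode-involutive (a , b) = cong₂ _,_ (Em.antipode-involutive a) (En.antipode-involutive b)

    dist-two-from-antipode : ∀ {d f} → Perp f d → ∀ x → dist x (move f (move d (antipode x))) + 2 ≡ diameter
    dist-two-from-antipode {d} {f} f⊥d x = trans (cong (dist x y +_) (sym y-x̄≡2)) (antipode-sum x y)
      where
      y : Vertex
      y = move f (move d (antipode x))
      y-x̄≡2 : dist y (antipode x) ≡ 2
      y-x̄≡2 = trans (dist-sym (antipode x) y) (dist-move-move≡2 f⊥d (antipode x))

  -- Along an odd axis farthest points come in adjacent pairs, so a vertex v farthest from w has a
  -- neighbour move h v that is also farthest from w.
  FarNeighbour : Vertex → Vertex → Set
  FarNeighbour w v = ∃ λ h → dist w (move h v) ≡ diameter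
    × (∀ g → suc (dist w (move g v)) ≡ diameter → g ≡ opp h ⊎ suc (suc (dist (move h w) (move g v))) ≡ diameter)

  far-neighbour : ¬ 2 ∣ m ⊎ ¬ 2 ∣ n → ∀ {w v} → dist w v ≡ diameter → FarNeighbour w v
  far-neighbour (inj₁ 2∤m) {a , b} {a' , b'} d≡ with diameter-split {a} {b} d≡
  ... | ca≡ , cb≡ with Cm.Odd.antipode-neighbour 2∤m ca≡
  ...   | s , far , near = (horizontal , s) , far-dist , others
    where
    far-dist : dist (a , b) (a' ⊕[ s ] 1 , b') ≡ diameter
    far-dist = cong₂ _+_ far cb≡
    others : ∀ g → suc (dist (a , b) (move g (a' , b'))) ≡ diameter →
             g ≡ (horizontal , flip s) ⊎ suc (suc (dist (a ⊕[ s ] 1 , b) (move g (a' , b')))) ≡ diameter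
    others (horizontal , t) hyp with sign-cases s t
    ... | inj₁ refl = contradiction (trans (cong suc (sym far-dist)) hyp) 1+n≢n
    ... | inj₂ refl = inj₁ refl
    others (vertical , t) hyp = inj₂ (begin
      suc (suc (Cm.cdist (a ⊕[ s ] 1) a' + c))  ≡⟨ cong (λ x → suc (suc (x + c))) near ⟩
      suc (suc (Cm.half ∸ 1) + c)               ≡⟨ cong (λ x → suc (x + c)) (m+[n∸m]≡n Cm.1≤half) ⟩
      suc (Cm.half + c)                         ≡⟨ cong (λ x → suc (x + c)) ca≡ ⟨
      suc (Cm.cdist a a' + c)                   ≡⟨ hyp ⟩
      diameter                                  ∎)
      where
      open ≡-Reasoning
      c = Cn.cdist b (b' ⊕′[ t ] 1)
  far-neighbour (inj₂ 2∤n) {a , b} {a' , b'} d≡ with diameter-split {a} {b} d≡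
  ... | ca≡ , cb≡ with Cn.Odd.antipode-neighbour 2∤n cb≡
  ...   | s , far , near = (vertical , s) , far-dist , others
    where
    far-dist : dist (a , b) (a' , b' ⊕′[ s ] 1) ≡ diameter
    far-dist = cong₂ _+_ ca≡ far
    others : ∀ g → suc (dist (a , b) (move g (a' , b'))) ≡ diameter →
             g ≡ (vertical , flip s) ⊎ suc (suc (dist (a , b ⊕′[ s ] 1) (move g (a' , b')))) ≡ diameter
    others (vertical , t) hyp with sign-cases s t
    ... | inj₁ refl = contradiction (trans (cong suc (sym far-dist)) hyp) 1+n≢n
    ... | inj₂ refl = inj₁ refl
    others (horizontal , t) hyp = inj₂ (begin
      suc (suc (c + Cn.cdist (b ⊕′[ s ] 1) b'))  ≡⟨ cong (λ x → suc (suc (c + x))) near ⟩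
      suc (suc (c + (Cn.half ∸ 1)))              ≡⟨ cong suc (+-suc c (Cn.half ∸ 1)) ⟨
      suc (c + suc (Cn.half ∸ 1))                ≡⟨ cong (λ x → suc (c + x)) (m+[n∸m]≡n Cn.1≤half) ⟩
      suc (c + Cn.half)                          ≡⟨ cong (λ x → suc (c + x)) cb≡ ⟨
      suc (c + Cn.cdist b b')                    ≡⟨ hyp ⟩
      diameter                                   ∎)
      where
      open ≡-Reasoning
      c = Cm.cdist a (a' ⊕[ t ] 1)

-- Three-colourings of the torus

module ThreeColourings (m n : ℕ) (2≤m : 2 ≤ m) (2≤n : 2 ≤ n) (c : Fin m × Fin n → Fin 3) where

  open Torus m n 2≤m 2≤n
  open Colourings G using (TwoSingletonClasses; SingletonClass; colour-change)

  Exceptional : Set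
  Exceptional = 2 ∣ m × 2 ∣ n × ¬ 2 ∣ diameter × TwoSingletonClasses c

  Outcome : Set
  Outcome = HasRainbow3AP G c ⊎ Exceptional

  coloured-≢ : ∀ {x y i j} → c x ≡ i → c y ≡ j → i ≢ j → c x ≢ c y
  coloured-≢ cx≡i cy≡j i≢j cx≡cy = i≢j (trans (sym cx≡i) (trans cx≡cy cy≡j))

  module _ {i j k : Fin 3} (i≢j : i ≢ j) (j≢k : j ≢ k) (i≢k : i ≢ k) where

    rainbow-coloured : ∀ {x y z} → c x ≡ i → c y ≡ j → c z ≡ k → dist x y ≡ dist y z → Outcome
    rainbow-coloured {x} {y} {z} cx cy cz xy≡yz =
      inj₁ (rainbow c x y z xy≡yz (coloured-≢ cx cy i≢j) (coloured-≢ cy cz j≢k) (coloured-≢ cx cz i≢k))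

  -- The state of the descent: the colours of u, move e u and w are called X, Y and Z below.
  record Frontier (a : ℕ) : Set where
    constructor frontier
    field
      u   : Vertex
      e   : Dir
      w   : Vertex
      X≢Y : c u ≢ c (move e u)
      Y≢Z : c (move e u) ≢ c w
      X≢Z : c u ≢ c w
      w-u : dist w u ≡ a
      w-v : dist w (move e u) ≡ suc a

  edge-frontier : ∀ {a u v w} → Adj G u v → c u ≢ c v → c v ≢ c w → c u ≢ c w →
                  dist w u ≡ a → dist w v ≡ suc a → Frontier a
  edge-frontier {a} {u} {v} {w} u~v X≢Y Y≢Z X≢Z w-u w-v =
    frontier u e w (subst (λ t → c u ≢ c t) v≡ X≢Y) (subst (λ t → c t ≢ c w) v≡ Y≢Z) X≢Z w-u
             (subst (λ t → dist w t ≡ suc a) v≡ w-v)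
    where
    e : Dir
    e = proj₁ (adjacent⇒move u~v)
    v≡ : v ≡ move e u
    v≡ = proj₂ (adjacent⇒move u~v)

  Below : ℕ → Set
  Below a = ∀ {b} → b < a → Frontier b → Outcome

  module _ {a} (below : Below a) {i j k : Fin 3} (i≢j : i ≢ j) (j≢k : j ≢ k) (i≢k : i ≢ k) where

    -- Orient the edge p — q so that the endpoint nearer to r comes first.
    reduce : ∀ {p q r} → c p ≡ i → c q ≡ j → c r ≡ k → Adj G p q → dist r p < a → Outcome
    reduce {p} {q} {r} cp cq cr p~q rp<a with <-cmp (dist r p) (dist r q)
    ... | tri≈ _ rp≡rq _ = rainbow-coloured i≢k (≢-sym j≢k) i≢j cp cr cq (trans (dist-sym r p) rp≡rq)
    ... | tri< rp<rq _ _ = below rp<a (edge-frontier p~q (coloured-≢ cp cq i≢j) (coloured-≢ cq cr j≢k)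
                                        (coloured-≢ cp cr i≢k) refl (≤-antisym (δ-edgeʳ r p~q) rp<rq))
    ... | tri> _ _ rq<rp = below (<-trans rq<rp rp<a)
                                 (edge-frontier (adjacent-sym p~q) (coloured-≢ cq cp (≢-sym i≢j))
                                   (coloured-≢ cp cr i≢k) (coloured-≢ cq cr j≢k) refl
                                   (≤-antisym (δ-edgeʳ r (adjacent-sym p~q)) rq<rp))

  module _ {a} (F : Frontier a) where
    open Frontier F

    -- Whatever the colour of the vertex z given by corner, a rainbow appears unless move f u has colour Y.
    corner-colour : suc a < diameter → ∀ f → Perp f e → c (move f u) ≡ c (move e u) ⊎ Outcome
    corner-colour 1+a<D f f⊥e with corner u e f (f⊥e ∘ sym) a (subst (_≤ diameter) (+-comm 2 a) 1+a<D)
    ... | z , z-u , z-v , z-f with fin3-cases X≢Y Y≢Z X≢Z (c z)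
    ...   | inj₁ cz≡X = inj₂ (rainbow-coloured X≢Y Y≢Z X≢Z cz≡X refl refl
                                (trans z-v (trans (sym w-v) (dist-sym (move e u) w))))
    ...   | inj₂ (inj₁ cz≡Y) = inj₂ (rainbow-coloured (≢-sym X≢Y) X≢Z Y≢Z cz≡Y refl refl
                                       (trans z-u (trans (sym w-u) (dist-sym u w))))
    ...   | inj₂ (inj₂ cz≡Z) with fin3-cases X≢Y Y≢Z X≢Z (c (move f u))
    ...     | inj₁ cf≡X        = inj₂ (rainbow-coloured Y≢Z (≢-sym X≢Z) (≢-sym X≢Y) refl cz≡Z cf≡X
                                          (trans (dist-sym z (move e u)) (trans z-v (sym z-f))))
    ...     | inj₂ (inj₁ cf≡Y) = inj₁ cf≡Y
    ...     | inj₂ (inj₂ cf≡Z) = inj₂ (rainbow-coloured (≢-sym X≢Y) X≢Z Y≢Z refl refl cf≡Z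
                                          (trans (dist-sym u (move e u)) (trans (dist-move≡1 e u) (sym (dist-move≡1 f u)))))

  module Step {a} (below : Below a) (F : Frontier a) where
    open Frontier F public

    v : Vertex
    v = move e u

    X Y Z : Fin 3
    X = c u
    Y = c v
    Z = c w

    Y≢X : Y ≢ X
    Y≢X = ≢-sym X≢Y
    Z≢Y : Z ≢ Y
    Z≢Y = ≢-sym Y≢Z
    Z≢X : Z ≢ X
    Z≢X = ≢-sym X≢Z

    colour-cases : ∀ x → c x ≡ X ⊎ c x ≡ Y ⊎ c x ≡ Z
    colour-cases x = fin3-cases X≢Y Y≢Z X≢Z (c x)

    u-v : dist u v ≡ 1
    u-v = dist-move≡1 e u

    between-⇒< : ∀ {x} → Between w x u → 1 ≤ dist w x → dist x u < a
    between-⇒< {x} between 1≤wx = subst (dist x u <_) (trans (+-comm (dist x u) (dist w x)) (trans between w-u))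
                                        (m<m+n (dist x u) 1≤wx)

    between-≤ : ∀ {x} → Between w x u → dist w x ≤ a
    between-≤ {x} between = subst (dist w x ≤_) (trans between w-u) (m≤m+n (dist w x) (dist x u))

    InteriorX : ℕ → Set
    InteriorX k = ∀ {x} → dist w x ≡ k → Between w x u → c x ≡ X ⊎ Outcome

    interior-X-base : InteriorX 1
    interior-X-base {x} wx≡1 between with colour-cases x
    ... | inj₁ cx≡X        = inj₁ cx≡X
    ... | inj₂ (inj₁ cx≡Y) = inj₂ (reduce below Y≢Z Z≢X Y≢X cx≡Y refl refl
                                    (δ≡1⇒adjacent (trans (dist-sym w x) wx≡1))
                                    (subst (_< a) (sym (dist-sym x u)) (between-⇒< between (≤-reflexive (sym wx≡1)))))
    ... | inj₂ (inj₂ cx≡Z) = inj₂ (reduce below X≢Y Y≢Z X≢Z refl refl cx≡Z (move-adjacent e u)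
                                    (between-⇒< between (≤-reflexive (sym wx≡1))))

    interior-X-step : ∀ k → InteriorX (suc k) → InteriorX (suc (suc k))
    interior-X-step k interior {x} wx≡ between = via (between-predecessor {w} {x} {u} wx≡ between)
      where
      via : (∃ λ x' → Adj G x' x × dist w x' ≡ suc k × Between w x' u) → c x ≡ X ⊎ Outcome
      via (x' , x'~x , wx'≡ , between') with interior wx'≡ between' | colour-cases x
      ... | inj₂ out   | _                = inj₂ out
      ... | inj₁ _     | inj₁ cx≡X        = inj₁ cx≡X
      ... | inj₁ cx'≡X | inj₂ (inj₁ cx≡Y) = inj₂ (reduce below X≢Y Y≢Z X≢Z cx'≡X cx≡Y refl x'~x
                                              (subst (_< a) (sym wx'≡) (subst (_≤ a) wx≡ (between-≤ between))))
      ... | inj₁ _     | inj₂ (inj₂ cx≡Z) = inj₂ (reduce below X≢Y Y≢Z X≢Z refl refl cx≡Z (move-adjacent e u)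
                                              (between-⇒< between (subst (1 ≤_) (sym wx≡) (s≤s z≤n))))

    interior-X : ∀ k → 1 ≤ k → InteriorX k
    interior-X 1                _ = interior-X-base
    interior-X (suc (suc k))    _ = interior-X-step k (interior-X (suc k) (s≤s z≤n))

    first-step : 1 ≤ a → (∃ λ g → dist w g ≡ 1 × Between w g u × c g ≡ X) ⊎ Outcome
    first-step 1≤a = via (point-between w u 1 (subst (1 ≤_) (sym w-u) 1≤a))
      where
      via : (∃ λ g → dist w g ≡ 1 × Between w g u) → (∃ λ g → dist w g ≡ 1 × Between w g u × c g ≡ X) ⊎ Outcome
      via (g , wg≡1 , between) = map₁ (λ cg≡X → g , wg≡1 , between , cg≡X) (interior-X-base wg≡1 between)

    f : Dir
    f = perpendicular e

    f⊥e : Perp f e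
    f⊥e = ≢-sym (perpendicular-Perp e)

    w-f≤1+a : dist w (move f u) ≤ suc a
    w-f≤1+a = subst (λ t → dist w (move f u) ≤ suc t) w-u (δ-edgeʳ w (move-adjacent f u))

    -- By corner-colour move f u has colour Y. It is nearer to w than u, as near, or as far as v;
    -- in the last case u — move f u is a frontier whose corner-colour gives move (opp e) u colour Y.
    behind-u-X : suc a < diameter → c (move (opp e) u) ≡ X → Outcome
    behind-u-X 1+a<D cu'≡X with corner-colour F 1+a<D f f⊥e
    ... | inj₂ out = out
    ... | inj₁ cf≡Y with <-cmp (dist w (move f u)) a
    ...   | tri< w-f<a _ _ = reduce below Y≢X X≢Z Y≢Z cf≡Y refl refl (adjacent-sym (move-adjacent f u)) w-f<a
    ...   | tri≈ _ w-f≡a _ = rainbow-coloured X≢Z Z≢Y X≢Y refl refl cf≡Y (trans (dist-sym w u) (trans w-u (sym w-f≡a)))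
    ...   | tri> _ _ a<w-f with corner-colour (frontier u f w (coloured-≢ refl cf≡Y X≢Y) (coloured-≢ cf≡Y refl Y≢Z) X≢Z
                                                 w-u (≤-antisym w-f≤1+a a<w-f))
                                               1+a<D (opp e) (perpendicular-Perp e)
    ...     | inj₁ cu'≡cf = contradiction (trans (sym cu'≡X) (trans cu'≡cf cf≡Y)) X≢Y
    ...     | inj₂ out   = out

    -- The neighbour u' of u towards w has colour X: it is not v, and sideways corner-colour would give it colour Y.
    far-case : 2 ≤ a → suc a < diameter → Outcome
    far-case 2≤a 1+a<D = via (between-predecessor {w} {u} {u} (trans w-u (sym 1+[a∸1]≡a)) (between-end w u))
      where
      1+[a∸1]≡a : suc (a ∸ 1) ≡ a
      1+[a∸1]≡a = m+[n∸m]≡n (≤-trans (s≤s z≤n) 2≤a)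
      via : (∃ λ u' → Adj G u' u × dist w u' ≡ a ∸ 1 × Between w u' u) → Outcome
      via (u' , u'~u , wu'≡ , between) with interior-X (a ∸ 1) (∸-monoˡ-≤ 1 2≤a) wu'≡ between | adjacent⇒move (adjacent-sym u'~u)
      ... | inj₂ out   | _ = out
      ... | inj₁ cu'≡X | g , refl with dir-cases e g
      ...   | inj₁ refl = contradiction (trans (sym w-v) wu'≡) (<⇒≢ (s≤s (m∸n≤m a 1)) ∘ sym)
      ...   | inj₂ (inj₁ refl) = behind-u-X 1+a<D cu'≡X
      ...   | inj₂ (inj₂ g⊥e) with corner-colour F 1+a<D g g⊥e
      ...     | inj₁ cu'≡Y = contradiction (trans (sym cu'≡X) cu'≡Y) X≢Y
      ...     | inj₂ out   = out

    w-v≡D : suc a ≡ diameter → dist w v ≡ diameter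
    w-v≡D 1+a≡D = trans w-v 1+a≡D

    -- The midpoint x of a shortest path from w to u is equidistant from w and v.
    even-diameter : suc a ≡ diameter → 2 ∣ diameter → Outcome
    even-diameter 1+a≡D (divides h D≡h*2) = via (point-between w u h (subst (h ≤_) (sym w-u) h≤a))
      where
      h+h≡1+a : h + h ≡ suc a
      h+h≡1+a = sym (trans 1+a≡D (trans D≡h*2 (trans (*-comm h 2) (cong (h +_) (+-identityʳ h)))))
      1≤h : 1 ≤ h
      1≤h = n≢0⇒n>0 (λ h≡0 → 0≢1+n (trans (cong (λ t → t + t) (sym h≡0)) h+h≡1+a))
      h≤a : h ≤ a
      h≤a = ≤-pred (subst (suc h ≤_) h+h≡1+a (subst (_≤ h + h) (+-comm h 1) (+-monoʳ-≤ h 1≤h)))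
      via : (∃ λ x → dist w x ≡ h × Between w x u) → Outcome
      via (x , wx≡h , between) with interior-X h 1≤h wx≡h between
      ... | inj₂ out   = out
      ... | inj₁ cx≡X  = rainbow-coloured Z≢X X≢Y Z≢Y refl cx≡X refl (trans wx≡h (sym x-v≡h))
        where
        h+xu≡a : h + dist x u ≡ a
        h+xu≡a = trans (cong (_+ dist x u) (sym wx≡h)) (trans between w-u)
        xu+1≡h : dist x u + 1 ≡ h
        xu+1≡h = +-cancelˡ-≡ h _ _ (begin
          h + (dist x u + 1)   ≡⟨ +-assoc h (dist x u) 1 ⟨
          h + dist x u + 1     ≡⟨ cong (_+ 1) h+xu≡a ⟩
          a + 1                ≡⟨ +-comm a 1 ⟩
          suc a                ≡⟨ h+h≡1+a ⟨
          h + h                ∎)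
          where open ≡-Reasoning
        x-v≡h : dist x v ≡ h
        x-v≡h = ≤-antisym
          (≤-trans (triangle x u v) (≤-reflexive (trans (cong (dist x u +_) u-v) xu+1≡h)))
          (+-cancelˡ-≤ h h (dist x v) (begin
            h + h                ≡⟨ h+h≡1+a ⟩
            suc a                ≡⟨ w-v ⟨
            dist w v             ≤⟨ triangle w x v ⟩
            dist w x + dist x v  ≡⟨ cong (_+ dist x v) wx≡h ⟩
            h + dist x v         ∎))
          where open ≤-Reasoning

    module _ (1+a≡D : suc a ≡ diameter) (h : Dir) (w-hv≡D : dist w (move h v) ≡ diameter) where

      w° : Vertex
      w° = move (opp h) w

      w°-v : dist w° v ≡ diameter
      w°-v = trans (sym (dist-translate h w° v))
                   (trans (cong (λ t → dist t (move h v)) (subst (λ d → move d w° ≡ w) (opp-involutive h) (move-opp (opp h) w)))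
                          w-hv≡D)

      w°-behind : dist w° (move (opp h) v) ≡ diameter
      w°-behind = trans (dist-translate (opp h) w v) (w-v≡D 1+a≡D)

      -- w° lies behind w, so it is farthest from both v and u = move (opp h) v.
      behind-w : ∀ {g₁} → dist w g₁ ≡ 1 → c g₁ ≡ X → u ≡ move (opp h) v → Outcome
      behind-w {g₁} wg₁≡1 cg₁≡X u≡ with colour-cases w°
      ... | inj₁ cw°≡X        = rainbow-coloured Z≢Y Y≢X Z≢X refl refl cw°≡X
                                  (trans (w-v≡D 1+a≡D) (sym (trans (dist-sym w° v) w°-v)))
      ... | inj₂ (inj₁ cw°≡Y) = rainbow-coloured X≢Z Z≢Y X≢Y cg₁≡X refl cw°≡Y
                                  (trans (dist-sym w g₁) (trans wg₁≡1 (sym (dist-move≡1 (opp h) w))))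
      ... | inj₂ (inj₂ cw°≡Z) = rainbow-coloured X≢Z Z≢Y X≢Y refl cw°≡Z refl
                                  (trans (dist-sym w° u) (trans (cong (dist w°) u≡) (trans w°-behind (sym w°-v))))

      -- x = move h w is next to w on a shortest path to u, hence has colour X, and is as far from move h v as w is.
      beside-w : c (move h v) ≡ Y → suc (suc (dist (move h w) (move (opp e) v))) ≡ diameter → Outcome
      beside-w chv≡Y far = via (interior-X-base (dist-move≡1 h w) between)
        where
        x : Vertex
        x = move h w
        between : Between w x u
        between = begin
          dist w x + dist x u ≡⟨ cong (_+ dist x u) (dist-move≡1 h w) ⟩
          suc (dist x u)      ≡⟨ suc-injective (trans (cong (λ t → suc (suc (dist x t))) (sym (move-opp e u)))
                                                      (trans far (sym 1+a≡D))) ⟩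
          a                   ≡⟨ w-u ⟨
          dist w u            ∎
          where open ≡-Reasoning
        via : c x ≡ X ⊎ Outcome → Outcome
        via (inj₂ out)  = out
        via (inj₁ cx≡X) = rainbow-coloured Z≢Y Y≢X Z≢X refl chv≡Y cx≡X
                            (trans w-hv≡D (sym (trans (dist-translate h v w) (trans (dist-sym w v) (w-v≡D 1+a≡D)))))

    odd-axis : ¬ 2 ∣ m ⊎ ¬ 2 ∣ n → 1 ≤ a → suc a ≡ diameter → Outcome
    odd-axis odd 1≤a 1+a≡D with first-step 1≤a | far-neighbour odd (w-v≡D 1+a≡D)
    ... | inj₂ out | _ = out
    ... | inj₁ (g₁ , wg₁≡1 , _ , cg₁≡X) | h , w-hv≡D , others with colour-cases (move h v)
    ...   | inj₁ chv≡X        = rainbow-coloured Y≢Z Z≢X Y≢X refl refl chv≡X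
                                  (trans (dist-sym w v) (trans (w-v≡D 1+a≡D) (sym w-hv≡D)))
    ...   | inj₂ (inj₂ chv≡Z) = rainbow-coloured X≢Y Y≢Z X≢Z refl refl chv≡Z (trans u-v (sym (dist-move≡1 h v)))
    ...   | inj₂ (inj₁ chv≡Y) with others (opp e) (trans (cong (λ t → suc (dist w t)) (move-opp e u)) (trans (cong suc w-u) 1+a≡D))
    ...     | inj₁ opp-e≡opp-h = behind-w 1+a≡D h w-hv≡D wg₁≡1 cg₁≡X
                                   (trans (sym (move-opp e u)) (cong (λ d → move d v) opp-e≡opp-h))
    ...     | inj₂ far         = beside-w 1+a≡D h w-hv≡D chv≡Y far

    module _ (2∣m : 2 ∣ m) (2∣n : 2 ∣ n) (1+a≡D : suc a ≡ diameter) where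
      open Antipodes 2∣m 2∣n

      w≡antipode-v : w ≡ antipode v
      w≡antipode-v = antipode-unique (trans (dist-sym w v) (w-v≡D 1+a≡D))

      +2≡1+⇒< : ∀ {x} → x + 2 ≡ suc a → x < a
      +2≡1+⇒< {x} x+2≡1+a = ≤-reflexive (suc-injective (trans (+-comm 2 x) x+2≡1+a))

      -- z is the antipode of u, hence sits behind w; the neighbours q and q' of w and z in a
      -- perpendicular direction are both close to u and v and force a rainbow.
      opposite-corner : ∀ {z} → c z ≡ Z → dist z u ≡ suc a → Outcome
      opposite-corner {z} cz≡Z z-u = finish (colour-cases q) (colour-cases q')
        where
        q q' : Vertex
        q  = move f w
        q' = move f z
        z≡behind-antipode-v : z ≡ move (opp e) (antipode v)
        z≡behind-antipode-v = begin
          z                          ≡⟨ antipode-unique (trans (dist-sym z u) (trans z-u 1+a≡D)) ⟩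
          antipode u                 ≡⟨ cong antipode (move-opp e u) ⟨
          antipode (move (opp e) v)  ≡⟨ antipode-move (opp e) v ⟩
          move (opp e) (antipode v)  ∎
          where open ≡-Reasoning
        u-q+2 : dist u q + 2 ≡ suc a
        u-q+2 = trans (cong (λ t → dist u (move f t) + 2) (trans w≡antipode-v (antipode-move e u)))
                      (trans (dist-two-from-antipode f⊥e u) (sym 1+a≡D))
        v-q'+2 : dist v q' + 2 ≡ suc a
        v-q'+2 = trans (cong (λ t → dist v (move f t) + 2) z≡behind-antipode-v)
                       (trans (dist-two-from-antipode f⊥e v) (sym 1+a≡D))
        q-q'≡1 : dist q q' ≡ 1
        q-q'≡1 = trans (dist-translate f w z)
                       (trans (cong (dist w) (trans z≡behind-antipode-v (cong (move (opp e)) (sym w≡antipode-v))))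
                              (dist-move≡1 (opp e) w))
        finish : c q ≡ X ⊎ c q ≡ Y ⊎ c q ≡ Z → c q' ≡ X ⊎ c q' ≡ Y ⊎ c q' ≡ Z → Outcome
        finish (inj₂ (inj₁ cq≡Y)) _ = reduce below Y≢Z Z≢X Y≢X cq≡Y refl refl (adjacent-sym (move-adjacent f w))
                                        (+2≡1+⇒< u-q+2)
        finish (inj₂ (inj₂ cq≡Z)) _ = reduce below X≢Y Y≢Z X≢Z refl refl cq≡Z (move-adjacent e u)
                                        (subst (_< a) (dist-sym q u) (+2≡1+⇒< u-q+2))
        finish (inj₁ _) (inj₁ cq'≡X) = reduce below X≢Z Z≢Y X≢Y cq'≡X cz≡Z refl (adjacent-sym (move-adjacent f z))
                                         (+2≡1+⇒< v-q'+2)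
        finish (inj₁ _) (inj₂ (inj₂ cq'≡Z)) = reduce below Y≢X X≢Z Y≢Z refl refl cq'≡Z (adjacent-sym (move-adjacent e u))
                                                (subst (_< a) (dist-sym q' v) (+2≡1+⇒< v-q'+2))
        finish (inj₁ cq≡X) (inj₂ (inj₁ cq'≡Y)) = rainbow-coloured Z≢X X≢Y Z≢Y refl cq≡X cq'≡Y
                                                   (trans (dist-move≡1 f w) (sym q-q'≡1))

      dist≤1+a : ∀ x y → dist x y ≤ suc a
      dist≤1+a x y = subst (dist x y ≤_) (sym 1+a≡D) (dist≤diameter x y)

      colour-Z⇒w : ∀ z → c z ≡ Z → z ≡ w ⊎ Outcome
      colour-Z⇒w z cz≡Z with dist z u <? a | dist z v <? a
      ... | yes z-u<a | _ = inj₂ (reduce below X≢Y Y≢Z X≢Z refl refl cz≡Z (move-adjacent e u) z-u<a)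
      ... | no _ | yes z-v<a = inj₂ (reduce below Y≢X X≢Z Y≢Z refl refl cz≡Z (adjacent-sym (move-adjacent e u)) z-v<a)
      ... | no z-u≮a | no z-v≮a with m≤n≤1+m⇒n≡m⊎n≡1+m (≮⇒≥ z-u≮a) (dist≤1+a z u)
                                   | m≤n≤1+m⇒n≡m⊎n≡1+m (≮⇒≥ z-v≮a) (dist≤1+a z v)
      ... | _ | inj₂ z-v≡1+a = inj₁ (trans (antipode-unique (trans (dist-sym z v) (trans z-v≡1+a 1+a≡D)))
                                           (sym w≡antipode-v))
      ... | inj₁ z-u≡a | inj₁ z-v≡a = inj₂ (rainbow-coloured X≢Z Z≢Y X≢Y refl cz≡Z refl
                                              (trans (dist-sym z u) (trans z-u≡a (sym z-v≡a))))
      ... | inj₂ z-u≡1+a | inj₁ _ = inj₂ (opposite-corner cz≡Z z-u≡1+a)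

      singleton-Z : ∀ z → (c z ≡ Z → z ≡ w) ⊎ Outcome
      singleton-Z z with c z ≟ᶠ Z
      ... | yes cz≡Z = map₁ const (colour-Z⇒w z cz≡Z)
      ... | no cz≢Z  = inj₁ (λ cz≡Z → contradiction cz≡Z cz≢Z)

  -- Applied to F and to the frontier g₁ — w seen from v, singleton-Z shows that the colour classes
  -- of w and of v are singletons.
  exceptional : ∀ {a} → Below a → (F : Frontier a) → 2 ∣ m → 2 ∣ n → ¬ 2 ∣ diameter →
                1 ≤ a → suc a ≡ diameter → Outcome
  exceptional {a} below F 2∣m 2∣n D-odd 1≤a 1+a≡D = via (first-step 1≤a)
    where
    open Step below F
    via : (∃ λ g → dist w g ≡ 1 × Between w g u × c g ≡ X) ⊎ Outcome → Outcome
    via (inj₂ out) = out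
    via (inj₁ (g₁ , wg₁≡1 , between , cg₁≡X)) =
      both (fin²-choice _ (Step.singleton-Z below F′ 2∣m 2∣n 1+a≡D)) (fin²-choice _ (singleton-Z 2∣m 2∣n 1+a≡D))
      where
      both : (∀ z → c z ≡ Y → z ≡ v) ⊎ Outcome → (∀ z → c z ≡ Z → z ≡ w) ⊎ Outcome → Outcome
      both (inj₁ only-v) (inj₁ only-w) = inj₂ (2∣m , 2∣n , D-odd , Y , Z , Y≢Z , (v , only-v) , (w , only-w))
      both (inj₂ out)    _             = out
      both (inj₁ _)      (inj₂ out)    = out
      g₁~w : Adj G g₁ w
      g₁~w = adjacent-sym (δ≡1⇒adjacent wg₁≡1)
      v-w : dist v w ≡ suc a
      v-w = trans (dist-sym w v) w-v
      v-g₁ : dist v g₁ ≡ a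
      v-g₁ = ≤-antisym
        (≤-trans (triangle v u g₁) (≤-reflexive (begin
          dist v u + dist u g₁   ≡⟨ cong₂ _+_ (trans (dist-sym u v) u-v) (dist-sym g₁ u) ⟩
          1 + dist g₁ u          ≡⟨ cong (_+ dist g₁ u) wg₁≡1 ⟨
          dist w g₁ + dist g₁ u  ≡⟨ trans between w-u ⟩
          a                      ∎)))
        (≤-pred (subst (_≤ suc (dist v g₁)) v-w (δ-edgeʳ v g₁~w)))
        where open ≡-Reasoning
      F′ : Frontier a
      F′ = edge-frontier g₁~w (coloured-≢ cg₁≡X refl X≢Z) Z≢Y (coloured-≢ cg₁≡X refl X≢Y) v-g₁ v-w

  frontier-step : ∀ {a} → Below a → Frontier a → Outcome
  frontier-step {zero} below F = contradiction (cong c (sym (dist≡0⇒≡ w-u))) X≢Z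
    where open Step below F
  frontier-step {1} below F =
    rainbow-coloured Y≢X X≢Z Y≢Z refl refl refl (trans (dist-sym u v) (trans u-v (sym (trans (dist-sym w u) w-u))))
    where open Step below F
  frontier-step {a@(suc (suc _))} below F = dispatch (m≤n⇒m<n∨m≡n (subst (_≤ diameter) w-v (dist≤diameter w v)))
    where
    open Step below F
    dispatch : suc a < diameter ⊎ suc a ≡ diameter → Outcome
    dispatch (inj₁ 1+a<D) = far-case (s≤s (s≤s z≤n)) 1+a<D
    dispatch (inj₂ 1+a≡D) with 2 ∣? diameter | 2 ∣? m | 2 ∣? n
    ... | yes 2∣D | _       | _       = even-diameter 1+a≡D 2∣D
    ... | no D-odd | yes 2∣m | yes 2∣n = exceptional below F 2∣m 2∣n D-odd (s≤s z≤n) 1+a≡D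
    ... | no _    | no 2∤m  | _       = odd-axis (inj₁ 2∤m) (s≤s z≤n) 1+a≡D
    ... | no _    | yes _   | no 2∤n  = odd-axis (inj₂ 2∤n) (s≤s z≤n) 1+a≡D

  frontier-outcome : ∀ a → Frontier a → Outcome
  frontier-outcome = <-rec (λ a → Frontier a → Outcome) (λ _ below → frontier-step below)

  -- Some edge changes colour; with a vertex of the third colour it starts the descent.
  three-colouring-outcome : Surjective c → Outcome
  three-colouring-outcome surj with surj 0F | surj 1F
  ... | x₀ , cx₀≡0 | x₁ , cx₁≡1 with colour-change c (geodesic x₀ x₁) (coloured-≢ cx₀≡0 cx₁≡1 (λ ()))
  ...   | p , q , p~q , cp≢cq with third-colour (c p) (c q) cp≢cq
  ...     | k , k≢cp , k≢cq with surj k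
  ...       | r , cr≡k = reduce (λ {b} _ → frontier-outcome b) cp≢cq (≢-sym k≢cq) (≢-sym k≢cp) refl refl cr≡k p~q
                           (n<1+n (dist r p))

-- The anti-van der Waerden number of the torus

module TorusColourings (m n : ℕ) (3≤m : 3 ≤ m) (3≤n : 3 ≤ n) where

  2≤m : 2 ≤ m
  2≤m = ≤-trans (n≤1+n 2) 3≤m
  2≤n : 2 ≤ n
  2≤n = ≤-trans (n≤1+n 2) 3≤n

  open Torus m n 2≤m 2≤n public
  open Colourings G

  _≟V_ : DecidableEquality Vertex
  _≟V_ = ≡-dec _≟ᶠ_ _≟ᶠ_

  x₀ x₁ : Vertex
  x₀ = fromℕ< Cm.1≤m , fromℕ< Cn.1≤m
  x₁ = move (horizontal , ⁺) x₀

  2≤diameter : 2 ≤ diameter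
  2≤diameter = +-mono-≤ Cm.1≤half Cn.1≤half

  dist≢0⇒≢ : ∀ {x y} → dist x y ≢ 0 → y ≢ x
  dist≢0⇒≢ {x} dist≢0 refl = dist≢0 (dist-refl x)

  x₁≢x₀ : x₁ ≢ x₀
  x₁≢x₀ = dist≢0⇒≢ (λ d≡0 → 1+n≢0 (trans (sym (dist-move≡1 (horizontal , ⁺) x₀)) d≡0))

  isDiam : IsDiam G diameter
  isDiam = IsDiam-δ dist≤diameter (x₀ , diameter-attained x₀)

  more-than-four : ∀ (f : Vertex → Fin 4) → ¬ Injective _≡_ _≡_ f
  more-than-four f f-injective = <⇒≱ 4<m*n (injective⇒≤ {f = f ∘ Injection.to pairing} (Injection.injective pairing ∘ f-injective))
    where
    pairing : Injection _ _
    pairing = ↔⇒↣ (*↔× {m} {n})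
    4<m*n : 4 < m * n
    4<m*n = ≤-trans (s≤s (s≤s (s≤s (s≤s (s≤s z≤n))))) (*-mono-≤ 3≤m 3≤n)

  module _ (c : Vertex → Fin 3) (c-surj : Surjective c) where
    open ThreeColourings m n 2≤m 2≤n c

    rainbow-or-singletons : HasRainbow3AP G c ⊎ TwoSingletonClasses c
    rainbow-or-singletons = map₂ (proj₂ ∘ proj₂ ∘ proj₂) (three-colouring-outcome c-surj)

  -- Colour a vertex x₀ and its antipode a₀ with their own colours and everything else with the third:
  -- a 3-AP needs its centre equidistant from its ends, which fails at x₀, at a₀ and, by parity, elsewhere.
  module AntipodalColouring (2∣m : 2 ∣ m) (2∣n : 2 ∣ n) (D-odd : ¬ 2 ∣ diameter) where
    open Antipodes 2∣m 2∣n

    a₀ : Vertex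
    a₀ = antipode x₀

    diameter≢ : ∀ {k} → k < 2 → diameter ≢ k
    diameter≢ k<2 D≡k = <⇒≱ k<2 (subst (2 ≤_) D≡k 2≤diameter)

    a₀≢x₀ : a₀ ≢ x₀
    a₀≢x₀ = dist≢0⇒≢ (diameter≢ (s≤s z≤n) ∘ trans (sym (dist-antipode x₀)))

    x₁≢a₀ : x₁ ≢ a₀
    x₁≢a₀ x₁≡a₀ = diameter≢ (s≤s (s≤s z≤n))
      (trans (sym (dist-antipode x₀)) (trans (cong (dist x₀) (sym x₁≡a₀)) (dist-move≡1 (horizontal , ⁺) x₀)))

    colour : Vertex → Fin 3
    colour x with x ≟V x₀ | x ≟V a₀
    ... | yes _ | _     = 0F
    ... | no _  | yes _ = 1F
    ... | no _  | no _  = 2F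

    colour≡0⇒x₀ : ∀ {x} → colour x ≡ 0F → x ≡ x₀
    colour≡0⇒x₀ {x} _ with x ≟V x₀ | x ≟V a₀
    colour≡0⇒x₀ _  | yes x≡x₀ | _     = x≡x₀
    colour≡0⇒x₀ () | no _     | yes _
    colour≡0⇒x₀ () | no _     | no _

    colour≡1⇒a₀ : ∀ {x} → colour x ≡ 1F → x ≡ a₀
    colour≡1⇒a₀ {x} _ with x ≟V x₀ | x ≟V a₀
    colour≡1⇒a₀ () | yes _ | _
    colour≡1⇒a₀ _  | no _  | yes x≡a₀ = x≡a₀
    colour≡1⇒a₀ () | no _  | no _

    colour-surjective : Surjective colour
    colour-surjective 0F = x₀ , x₀-colour
      where
      x₀-colour : colour x₀ ≡ 0F
      x₀-colour with x₀ ≟V x₀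
      ... | yes _    = refl
      ... | no x≢x   = contradiction refl x≢x
    colour-surjective 1F = a₀ , a₀-colour
      where
      a₀-colour : colour a₀ ≡ 1F
      a₀-colour with a₀ ≟V x₀ | a₀ ≟V a₀
      ... | yes a₀≡x₀ | _      = contradiction a₀≡x₀ a₀≢x₀
      ... | no _      | yes _  = refl
      ... | no _      | no a≢a = contradiction refl a≢a
    colour-surjective 2F = x₁ , x₁-colour
      where
      x₁-colour : colour x₁ ≡ 2F
      x₁-colour with x₁ ≟V x₀ | x₁ ≟V a₀
      ... | yes x₁≡x₀ | _         = contradiction x₁≡x₀ x₁≢x₀
      ... | no _      | yes x₁≡a₀ = contradiction x₁≡a₀ x₁≢a₀
      ... | no _      | no _      = refl

    ends-equal : ∀ {y₁ y₂ y₃} → dist y₁ y₂ ≡ dist y₂ y₃ → y₁ ≡ antipode y₂ ⊎ y₃ ≡ antipode y₂ → y₁ ≡ y₃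
    ends-equal {y₁} {y₂} {y₃} equidistant (inj₁ refl) =
      sym (antipode-unique (trans (sym equidistant) (trans (dist-sym y₂ y₁) (dist-antipode y₂))))
    ends-equal {y₁} {y₂} {y₃} equidistant (inj₂ refl) =
      antipode-unique (trans (dist-sym y₁ y₂) (trans equidistant (dist-antipode y₂)))

    not-midway : ∀ y → dist x₀ y ≢ dist y a₀
    not-midway y midway = D-odd (divides (dist x₀ y) (begin
      diameter                     ≡⟨ antipode-sum x₀ y ⟨
      dist x₀ y + dist y a₀        ≡⟨ cong (dist x₀ y +_) midway ⟨
      dist x₀ y + dist x₀ y        ≡⟨ cong (dist x₀ y +_) (+-identityʳ (dist x₀ y)) ⟨
      2 * dist x₀ y                ≡⟨ *-comm 2 (dist x₀ y) ⟩
      dist x₀ y * 2                ∎))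
      where open ≡-Reasoning

    no-rainbow-AP : ∀ {y₁ y₂ y₃} → dist y₁ y₂ ≡ dist y₂ y₃ →
                    colour y₁ ≢ colour y₂ → colour y₂ ≢ colour y₃ → colour y₁ ≢ colour y₃ → ⊥
    no-rainbow-AP {y₁} {y₂} {y₃} equidistant c₁₂ c₂₃ c₁₃ =
      by-centre (fin3-cases {0F} {1F} {2F} (λ ()) (λ ()) (λ ()) (colour y₂))
      where
      end-coloured : ∀ {i j} → colour y₂ ≡ i → i ≢ j → colour y₁ ≡ j ⊎ colour y₃ ≡ j
      end-coloured {j = j} c₂≡i i≢j with fin3-cases c₁₂ c₂₃ c₁₃ j
      ... | inj₁ j≡c₁        = inj₁ (sym j≡c₁)
      ... | inj₂ (inj₁ j≡c₂) = contradiction (trans (sym c₂≡i) (sym j≡c₂)) i≢j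
      ... | inj₂ (inj₂ j≡c₃) = inj₂ (sym j≡c₃)
      antipodal-ends : y₁ ≡ antipode y₂ ⊎ y₃ ≡ antipode y₂ → ⊥
      antipodal-ends = c₁₃ ∘ cong colour ∘ ends-equal equidistant
      by-centre : colour y₂ ≡ 0F ⊎ colour y₂ ≡ 1F ⊎ colour y₂ ≡ 2F → ⊥
      by-centre (inj₁ c₂≡0) = antipodal-ends (map a₀-is-antipode a₀-is-antipode (end-coloured c₂≡0 (λ ())))
        where
        a₀-is-antipode : ∀ {y} → colour y ≡ 1F → y ≡ antipode y₂
        a₀-is-antipode cy≡1 = trans (colour≡1⇒a₀ cy≡1) (cong antipode (sym (colour≡0⇒x₀ c₂≡0)))
      by-centre (inj₂ (inj₁ c₂≡1)) = antipodal-ends (map x₀-is-antipode x₀-is-antipode (end-coloured c₂≡1 (λ ())))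
        where
        x₀-is-antipode : ∀ {y} → colour y ≡ 0F → y ≡ antipode y₂
        x₀-is-antipode cy≡0 = trans (colour≡0⇒x₀ cy≡0)
                                    (trans (sym (antipode-involutive x₀)) (cong antipode (sym (colour≡1⇒a₀ c₂≡1))))
      by-centre (inj₂ (inj₂ c₂≡2)) with end-coloured c₂≡2 (λ ()) | end-coloured c₂≡2 (λ ())
      ... | inj₁ c₁≡0 | inj₁ c₁≡1 = contradiction (trans (sym c₁≡0) c₁≡1) (λ ())
      ... | inj₂ c₃≡0 | inj₂ c₃≡1 = contradiction (trans (sym c₃≡0) c₃≡1) (λ ())
      ... | inj₁ c₁≡0 | inj₂ c₃≡1 = not-midway y₂
        (subst₂ (λ p q → dist p y₂ ≡ dist y₂ q) (colour≡0⇒x₀ c₁≡0) (colour≡1⇒a₀ c₃≡1) equidistant)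
      ... | inj₂ c₃≡0 | inj₁ c₁≡1 = not-midway y₂
        (subst₂ (λ p q → dist q y₂ ≡ dist y₂ p) (colour≡1⇒a₀ c₁≡1) (colour≡0⇒x₀ c₃≡0)
                (trans (dist-sym y₂ y₃) (trans (sym equidistant) (dist-sym y₂ y₁))))

    no-rainbow-3 : ¬ AllColoringsRainbow G 3
    no-rainbow-3 all with all colour colour-surjective
    ... | y₁ , y₂ , y₃ , (k , d₁₂ , d₂₃) , c₁₂ , c₂₃ , c₁₃ =
      no-rainbow-AP (trans (sym (Dist⇒≡δ y₁ y₂ k d₁₂)) (Dist⇒≡δ y₂ y₃ k d₂₃)) c₁₂ c₂₃ c₁₃

  fewer-than-three : ∀ s → 1 ≤ s → s < 3 → ¬ AllColoringsRainbow G s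
  fewer-than-three 1 _ _ = no-rainbow-1 x₀
  fewer-than-three 2 _ _ = no-rainbow-2 _≟V_ x₁≢x₀
  fewer-than-three (suc (suc (suc _))) _ (s≤s (s≤s (s≤s ())))

  aw≡3 : ¬ (2 ∣ m × 2 ∣ n × ¬ 2 ∣ diameter) → IsAw3 G 3
  aw≡3 not-exceptional = s≤s z≤n , all-rainbow , fewer-than-three
    where
    all-rainbow : AllColoringsRainbow G 3
    all-rainbow c c-surj = [ id , exceptional ]′ (ThreeColourings.three-colouring-outcome m n 2≤m 2≤n c c-surj)
      where
      exceptional : ThreeColourings.Exceptional m n 2≤m 2≤n c → HasRainbow3AP G c
      exceptional (2∣m , 2∣n , D-odd , _) = contradiction (2∣m , 2∣n , D-odd) not-exceptional

  aw≡4 : 2 ∣ m × 2 ∣ n × ¬ 2 ∣ diameter → IsAw3 G 4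
  aw≡4 (2∣m , 2∣n , D-odd) = s≤s z≤n , four-colours-rainbow more-than-four rainbow-or-singletons , fewer-than-four
    where
    fewer-than-four : ∀ s → 1 ≤ s → s < 4 → ¬ AllColoringsRainbow G s
    fewer-than-four 1 1≤s _ = fewer-than-three 1 1≤s (s≤s (s≤s z≤n))
    fewer-than-four 2 1≤s _ = fewer-than-three 2 1≤s (s≤s (s≤s (s≤s z≤n)))
    fewer-than-four 3 _ _   = AntipodalColouring.no-rainbow-3 2∣m 2∣n D-odd
    fewer-than-four (suc (suc (suc (suc _)))) _ (s≤s (s≤s (s≤s (s≤s ()))))

theorem7 : (m n : ℕ) → 3 ≤ m → 3 ≤ n →
  Σ ℕ λ D → IsDiam (Cycle m □ Cycle n) D
    × ((Even m × Even n × Odd D → IsAw3 (Cycle m □ Cycle n) 4)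
     × (¬ (Even m × Even n × Odd D) → IsAw3 (Cycle m □ Cycle n) 3))
theorem7 m n 3≤m 3≤n = diameter , isDiam , aw≡4 , aw≡3
  where open TorusColourings m n 3≤m 3≤n
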